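{- There exists a constant $C>0$ such that for all integers $m \ge 1$ and $1 \le k \le m$, \[ \binom{2m+1}{k} \le C\, 2^m k^{ -1/2} (1+\sqrt{2})^k . \] Moreover, the number $1+\sqrt{2}$ cannot be replaced by a smaller number: for every $0 < b < 1+\sqrt{2}$ there is no constant $C'>0$ such that $\binom{2m+1}{k} \le C' 2^m k^{ -1/2} b^k$ for all integers $m \ge 1$ and $1 \le k \le m$.
   Formalization: In the sharpness claim the number b and the constant C′ range over the positive rationals, and the constant C in the upper bound is taken rational. -}

module Defs where

open import Data.Nat as ℕ using (ℕ; zero; suc)
open import Data.Integer using (+_)
open import Data.Rational using (ℚ; 0ℚ; 1ℚ; _+_; _*_; _-_; _/_; _≤_; _<_)
open import Data.Product using (_×_)
open import Data.Sum using (_⊎_)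
open import Data.Empty using (⊥)

ℕ→ℚ : ℕ → ℚ
ℕ→ℚ n = + n / 1

_^ℚ_ : ℚ → ℕ → ℚ
x ^ℚ zero  = 1ℚ
x ^ℚ suc n = x * (x ^ℚ n)

-- The field ℚ(√2) ⊂ ℝ : an element  re + im·√2  with re, im ∈ ℚ.
record ℚ√2 : Set where
  constructor _+_√2
  field
    re im : ℚ
open ℚ√2 public

ι : ℚ → ℚ√2
ι q = q + 0ℚ √2

_⊕_ : ℚ√2 → ℚ√2 → ℚ√2
(a + b √2) ⊕ (c + d √2) = (a + c) + (b + d) √2

_⊖_ : ℚ√2 → ℚ√2 → ℚ√2
(a + b √2) ⊖ (c + d √2) = (a - c) + (b - d) √2

-- (a + b√2)(c + d√2) = (ac + 2bd) + (ad + bc)√2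
_⊗_ : ℚ√2 → ℚ√2 → ℚ√2
(a + b √2) ⊗ (c + d √2) = (a * c + ℕ→ℚ 2 * (b * d)) + (a * d + b * c) √2

_^√_ : ℚ√2 → ℕ → ℚ√2
x ^√ zero  = ι 1ℚ
x ^√ suc n = x ⊗ (x ^√ n)

1+√2 : ℚ√2
1+√2 = 1ℚ + 1ℚ √2

-- a + b√2 ≥ 0 as a real number (the order inherited from ℝ):
--   both a, b ≥ 0; or a ≥ 0 > b with 2b² ≤ a²; or b ≥ 0 > a with a² ≤ 2b².
NonNeg : ℚ√2 → Set
NonNeg (a + b √2) =
    (0ℚ ≤ a × 0ℚ ≤ b)
  ⊎ (0ℚ ≤ a × b < 0ℚ × ℕ→ℚ 2 * (b * b) ≤ a * a)
  ⊎ (a < 0ℚ × 0ℚ ≤ b × a * a ≤ ℕ→ℚ 2 * (b * b))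

infix 4 _≤√_ _<√_
_≤√_ : ℚ√2 → ℚ√2 → Set
x ≤√ y = NonNeg (y ⊖ x)

_<√_ : ℚ√2 → ℚ√2 → Set
x <√ y = x ≤√ y × (y ≤√ x → ⊥)

-- Write (1 + √2)^k = H k + P k √2 with H k, P k ∈ ℕ and n = 2m + 1 = k + a, so that k ≤ a.
--
-- The binomial theorem in ℕ[√2] gives ∑ⱼ C(n,j) (1 + √2)^(n−j) = (2 + √2)^n = 2^m √2 (1 + √2)^n,
-- so ∑ⱼ C(n,j) H(n−j) = 2^(m+1) P n ≤ 3·2^(m+1) H k H a. Let L = ⌊√k/2⌋. On the L + 1 indices j next to k
-- (above k if a ≥ (1 + √2) k, below k otherwise) the ratio C(n,j)/C(n,k) is at least half of (a/k)^(j−k), and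
-- (a/k)^i is at least H i in the first case and at most 3 H i in the second, so every such term C(n,j) H(n−j) is
-- at least C(n,k) H a / 6. Hence (L + 1) C(n,k) ≤ 36·2^m H k, i.e. k C(n,k)² ≤ (72·2^m H k)²; in ℚ(√2) this
-- suffices because (72·2^m (1 + √2)^k)² − k C(n,k)² then has nonnegative rational and √2-parts.
--
-- If b ≤ p/q < 1 + √2 with q ≤ p, then (p + q)² > 2p², so (p + q)^n eventually exceeds
-- (n + 1)·N·2^m·p^n. Since q ≤ p, each term C(n,j) q^j p^(n−j) with j > m is dominated by its mirror term,
-- so some term with 1 ≤ j ≤ m exceeds N·2^m·p^n, that is C(n,j) > N·2^m (p/q)^j ≥ C′·2^m b^j.

module Submission where

open import Algebra.Bundles using (CommutativeSemiring)
open import Data.Empty using (⊥; ⊥-elim)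
open import Data.Fin.Base as Fin using (Fin; toℕ; fromℕ<)
open import Data.Fin.Properties using (toℕ<n; toℕ-fromℕ<; ¬∀⟶∃¬)
open import Data.Integer as ℤ using (+_; -[1+_]; +≤+; +<+)
import Data.Integer.Properties as ℤ
open import Data.Nat
import Data.Nat.Coprimality as Coprime
open import Data.Nat.Combinatorics using (_C_; nC1≡n; nCk+nC[k+1]≡[n+1]C[k+1]; nCk≡nC[n∸k])
open import Data.Nat.Properties
open import Data.Nat.Tactic.RingSolver using (solve-∀)
open import Data.Product using (Σ; ∃-syntax; _×_; _,_; proj₁; proj₂)
open import Data.Rational using (ℚ; mkℚ; 0ℚ; 1ℚ; _-_; -_; *≤*; *<*; toℚᵘ; Positive; positive; nonNegative)
  renaming (_+_ to _+ℚ_; _*_ to _*ℚ_; _≤_ to _≤ℚ_; _<_ to _<ℚ_)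
import Data.Rational.Properties as ℚ
open import Data.Rational.Solver using (module +-*-Solver)
import Data.Rational.Unnormalised as ℚᵘ
import Data.Rational.Unnormalised.Properties as ℚᵘ
open import Data.Sum using (inj₁; inj₂)
open import Function.Base using (_⟨_⟩_; it)
open import Level using (0ℓ)
open import Relation.Binary.PropositionalEquality
open import Relation.Nullary using (¬_; yes; no)

import Algebra.Properties.CommutativeSemiring.Binomial +-*-commutativeSemiring as ℕ-Binomial
open import Algebra.Properties.CommutativeSemigroup *-commutativeSemigroup using (x∙yz≈y∙xz)
open import Algebra.Properties.Semiring.Exp +-*-semiring using () renaming (_^_ to _^′_)
open import Algebra.Properties.Semiring.Mult +-*-semiring using () renaming (_×_ to _×′_)
open import Algebra.Properties.Semiring.Sum +-*-semiring using (sum; sum⁺-syntax; sum-cong-≗; *-distribˡ-sum)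
open import Algebra.Structures {A = ℕ × ℕ} _≡_ using (IsCommutativeMonoid)
open import Algebra.Structures.Biased {A = ℕ × ℕ} _≡_ using (isCommutativeMonoidˡ; isCommutativeSemiringˡ)

open import Defs

^-distribʳ-* : ∀ m n i → (m * n) ^ i ≡ m ^ i * n ^ i
^-distribʳ-* m n zero = refl
^-distribʳ-* m n (suc i) = cong (m * n *_) (^-distribʳ-* m n i) ⟨ trans ⟩ swap m n (m ^ i) (n ^ i)
  where
  swap : ∀ m n x y → m * n * (x * y) ≡ m * x * (n * y)
  swap = solve-∀

mean-value-^ : ∀ u w i → (u + w) ^ i * (u + w) ≤ u ^ i * (u + w) + i * w * (u + w) ^ i
mean-value-^ u w zero = ≤-reflexive (base u w)
  where
  base : ∀ u w → 1 * (u + w) ≡ 1 * (u + w) + 0 * w * 1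
  base = solve-∀
mean-value-^ u w (suc i) = begin
  (u + w) * x * (u + w)                                          ≡⟨ expand u w x ⟩
  u * (x * (u + w)) + w * (x * (u + w))                          ≤⟨ +-monoˡ-≤ _ (*-monoʳ-≤ u (mean-value-^ u w i)) ⟩
  u * (y * (u + w) + i * w * x) + w * (x * (u + w))              ≡⟨ expand′ u w x y i ⟩
  u * y * (u + w) + i * w * (u * x) + w * ((u + w) * x)          ≤⟨ +-monoˡ-≤ _ (+-monoʳ-≤ (u * y * (u + w)) ux≤[u+w]x) ⟩
  u * y * (u + w) + i * w * ((u + w) * x) + w * ((u + w) * x)    ≡⟨ collect u w x y i ⟩
  u * y * (u + w) + suc i * w * ((u + w) * x)                    ∎
  where
  open ≤-Reasoning
  x = (u + w) ^ i
  y = u ^ i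
  ux≤[u+w]x : i * w * (u * x) ≤ i * w * ((u + w) * x)
  ux≤[u+w]x = *-monoʳ-≤ (i * w) (*-monoˡ-≤ x (m≤m+n u w))
  expand : ∀ u w x → (u + w) * x * (u + w) ≡ u * (x * (u + w)) + w * (x * (u + w))
  expand = solve-∀
  expand′ : ∀ u w x y i → u * (y * (u + w) + i * w * x) + w * (x * (u + w))
                        ≡ u * y * (u + w) + i * w * (u * x) + w * ((u + w) * x)
  expand′ = solve-∀
  collect : ∀ u w x y i → u * y * (u + w) + i * w * ((u + w) * x) + w * ((u + w) * x)
                        ≡ u * y * (u + w) + suc i * w * ((u + w) * x)
  collect = solve-∀

[u+w]^i≤2*u^i : ∀ {u w} i .{{_ : NonZero (u + w)}} → 2 * (i * w) ≤ u + w → (u + w) ^ i ≤ 2 * u ^ i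
[u+w]^i≤2*u^i {u} {w} i 2iw≤v = *-cancelʳ-≤ _ _ v (+-cancelʳ-≤ (v ^ i * v) _ _ (begin
  v ^ i * v + v ^ i * v                 ≡⟨ x+x≡2x (v ^ i * v) ⟩
  2 * (v ^ i * v)                       ≤⟨ *-monoʳ-≤ 2 (mean-value-^ u w i) ⟩
  2 * (u ^ i * v + i * w * v ^ i)       ≡⟨ distrib (u ^ i * v) (i * w) (v ^ i) ⟩
  2 * (u ^ i * v) + 2 * (i * w) * v ^ i ≤⟨ +-monoʳ-≤ _ (*-monoˡ-≤ (v ^ i) 2iw≤v) ⟩
  2 * (u ^ i * v) + v * v ^ i           ≡⟨ cong₂ _+_ (*-assoc 2 (u ^ i) v) (*-comm (v ^ i) v) ⟨
  2 * u ^ i * v + v ^ i * v             ∎))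
  where
  open ≤-Reasoning
  v = u + w
  x+x≡2x : ∀ x → x + x ≡ 2 * x
  x+x≡2x = solve-∀
  distrib : ∀ a b x → 2 * (a + b * x) ≡ 2 * a + 2 * b * x
  distrib = solve-∀

geometric-ratio : ∀ (f : ℕ → ℕ) {α β I} → (∀ {i} → i < I → α * f i ≤ β * f (suc i)) →
                  ∀ {i} → i ≤ I → α ^ i * f 0 ≤ β ^ i * f i
geometric-ratio f step {zero} _ = ≤-refl
geometric-ratio f {α} {β} step {suc i} i<I = begin
  α * α ^ i * f 0           ≡⟨ *-assoc α _ _ ⟩
  α * (α ^ i * f 0)         ≤⟨ *-monoʳ-≤ α (geometric-ratio f step (<⇒≤ i<I)) ⟩
  α * (β ^ i * f i)         ≡⟨ x∙yz≈y∙xz α (β ^ i) (f i) ⟩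
  β ^ i * (α * f i)         ≤⟨ *-monoʳ-≤ (β ^ i) (step i<I) ⟩
  β ^ i * (β * f (suc i))   ≡⟨ x∙yz≈y∙xz (β ^ i) β (f (suc i)) ⟨ trans ⟩ sym (*-assoc β _ _) ⟩
  β * β ^ i * f (suc i)     ∎
  where open ≤-Reasoning

B^M*[B+M]≤A^M*B : ∀ {A B} → B < A → ∀ M → B ^ M * (B + M) ≤ A ^ M * B
B^M*[B+M]≤A^M*B {A} {B} B<A zero = ≤-reflexive (cong (1 *_) (+-identityʳ B))
B^M*[B+M]≤A^M*B {A} {B} B<A (suc M) = begin
  B * x * (B + suc M)     ≤⟨ m≤m+n _ (x * M) ⟩
  B * x * (B + suc M) + x * M ≡⟨ regroup B x M ⟩
  suc B * (x * (B + M))   ≤⟨ *-mono-≤ B<A (B^M*[B+M]≤A^M*B B<A M) ⟩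
  A * (A ^ M * B)         ≡⟨ *-assoc A (A ^ M) B ⟨
  A * A ^ M * B           ∎
  where
  open ≤-Reasoning
  x = B ^ M
  regroup : ∀ B x M → B * x * (B + suc M) + x * M ≡ suc B * (x * (B + M))
  regroup = solve-∀

-- Squaring B ^ M * M ≤ A ^ M * B turns the linear gain in M into a quadratic one.
∃[m]K*m*B^m<A^m : ∀ {A B} .{{_ : NonZero B}} → B < A → ∀ K → ∃[ m ] 1 ≤ m × K * m * B ^ m < A ^ m
∃[m]K*m*B^m<A^m {A} {B} B<A K = M + M , ≤-trans (s≤s z≤n) (m≤m+n M M) ,
  *-cancelʳ-< (B * B) _ _ (begin-strict
    K * (M + M) * B ^ (M + M) * (B * B)      ≡⟨ cong (λ y → K * (M + M) * y * (B * B)) (^-distribˡ-+-* B M M) ⟩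
    K * (M + M) * (y * y) * (B * B)          ≡⟨ regroup K M y B ⟩
    2 * K * (B * B) * M * (y * y)            <⟨ *-monoˡ-< (y * y) {{m*n≢0 y y}} (*-monoˡ-< M (n<1+n (2 * K * (B * B)))) ⟩
    M * M * (y * y)                          ≡⟨ regroup′ M y ⟩
    (y * M) * (y * M)                        ≤⟨ *-mono-≤ y*M≤A^M*B y*M≤A^M*B ⟩
    (A ^ M * B) * (A ^ M * B)                ≡⟨ regroup″ (A ^ M) B ⟩
    A ^ M * A ^ M * (B * B)                  ≡⟨ cong (_* (B * B)) (^-distribˡ-+-* A M M) ⟨
    A ^ (M + M) * (B * B)                    ∎)
  where
  open ≤-Reasoning
  M = suc (2 * K * (B * B))
  y = B ^ M
  instance
    y≢0 : NonZero y
    y≢0 = m^n≢0 B M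
  y*M≤A^M*B : y * M ≤ A ^ M * B
  y*M≤A^M*B = ≤-trans (*-monoʳ-≤ y (m≤n+m M B)) (B^M*[B+M]≤A^M*B B<A M)
  regroup : ∀ K M y B → K * (M + M) * (y * y) * (B * B) ≡ 2 * K * (B * B) * M * (y * y)
  regroup = solve-∀
  regroup′ : ∀ M y → M * M * (y * y) ≡ (y * M) * (y * M)
  regroup′ = solve-∀
  regroup″ : ∀ x B → (x * B) * (x * B) ≡ x * x * (B * B)
  regroup″ = solve-∀

x^[2m+1]≡[x^2]^m*x : ∀ x m → x ^ (2 * m + 1) ≡ (x ^ 2) ^ m * x
x^[2m+1]≡[x^2]^m*x x m = ^-distribˡ-+-* x (2 * m) 1 ⟨ trans ⟩ cong₂ _*_ (sym (^-*-assoc x 2 m)) (*-identityʳ x)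

q^j*p^o≤q^o*p^j : ∀ {p q o j} → q ≤ p → o ≤ j → q ^ j * p ^ o ≤ q ^ o * p ^ j
q^j*p^o≤q^o*p^j {p} {q} {o} {j} q≤p o≤j = begin
  q ^ j * p ^ o              ≡⟨ cong (λ e → q ^ e * p ^ o) o+s≡j ⟨
  q ^ (o + s) * p ^ o        ≡⟨ cong (_* p ^ o) (^-distribˡ-+-* q o s) ⟩
  q ^ o * q ^ s * p ^ o      ≤⟨ *-monoˡ-≤ (p ^ o) (*-monoʳ-≤ (q ^ o) (^-monoˡ-≤ s q≤p)) ⟩
  q ^ o * p ^ s * p ^ o      ≡⟨ regroup (q ^ o) (p ^ s) (p ^ o) ⟩
  q ^ o * (p ^ o * p ^ s)    ≡⟨ cong (q ^ o *_) (^-distribˡ-+-* p o s) ⟨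
  q ^ o * p ^ (o + s)        ≡⟨ cong (λ e → q ^ o * p ^ e) o+s≡j ⟩
  q ^ o * p ^ j              ∎
  where
  open ≤-Reasoning
  s = j ∸ o
  o+s≡j : o + s ≡ j
  o+s≡j = m+[n∸m]≡n o≤j
  regroup : ∀ a b c → a * b * c ≡ a * (c * b)
  regroup = solve-∀

m≤2m+1 : ∀ m → m ≤ 2 * m + 1
m≤2m+1 m = ≤-trans (m≤n*m m 2) (m≤m+n (2 * m) 1)

[2m+1]∸[m+1]≡m : ∀ m → 2 * m + 1 ∸ suc m ≡ m
[2m+1]∸[m+1]≡m m = cong (_∸ suc m) (reorder m) ⟨ trans ⟩ m+n∸m≡n (suc m) m
  where
  reorder : ∀ m → 2 * m + 1 ≡ suc m + m
  reorder = solve-∀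

2[q+d]²<[q+d+q]² : ∀ {q d} → d * d < 2 * (q * q) → 2 * (q + d) ^ 2 < (q + d + q) ^ 2
2[q+d]²<[q+d+q]² {q} {d} d²<2q² = +-cancelʳ-< (d * d) _ _ (begin-strict
  2 * (q + d) ^ 2 + d * d           <⟨ +-monoʳ-< (2 * (q + d) ^ 2) d²<2q² ⟩
  2 * (q + d) ^ 2 + 2 * (q * q)     ≡⟨ parallelogram q d ⟩
  (q + d + q) ^ 2 + d * d           ∎)
  where
  open ≤-Reasoning
  parallelogram : ∀ q d → 2 * ((q + d) * ((q + d) * 1)) + 2 * (q * q) ≡ (q + d + q) * ((q + d + q) * 1) + d * d
  parallelogram = solve-∀

half-sqrt : ∀ k → ∃[ L ] 4 * (L * L) ≤ k × k < 4 * (suc L * suc L)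
half-sqrt zero = 0 , z≤n , s≤s z≤n
half-sqrt (suc k) with half-sqrt k
... | L , 4L²≤k , k<4[L+1]² with suc k <? 4 * (suc L * suc L)
...   | yes k+1<4[L+1]² = L , m≤n⇒m≤1+n 4L²≤k , k+1<4[L+1]²
...   | no  k+1≮4[L+1]² = suc L , ≤-reflexive (sym k+1≡4[L+1]²) , k+1<4[L+2]²
  where
  k+1≡4[L+1]² : suc k ≡ 4 * (suc L * suc L)
  k+1≡4[L+1]² = ≤-antisym k<4[L+1]² (≮⇒≥ k+1≮4[L+1]²)
  square : ∀ L → 4 * (suc (suc L) * suc (suc L)) ≡ suc (4 * (suc L * suc L)) + (8 * L + 11)
  square = solve-∀
  k+1<4[L+2]² : suc k < 4 * (suc (suc L) * suc (suc L))
  k+1<4[L+2]² = ≤-trans (s≤s (≤-reflexive k+1≡4[L+1]²)) (≤-trans (m≤m+n _ (8 * L + 11)) (≤-reflexive (sym (square L))))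

window≤∑ : ∀ n (f : ℕ → ℕ) {s L v} → s + L ≤ n → (∀ j → s ≤ j → j ≤ s + L → v ≤ f j) →
           suc L * v ≤ ∑[ j ≤ n ] f (toℕ j)
window≤∑ zero    f {zero} {zero} _ v≤f = +-monoˡ-≤ 0 (v≤f 0 z≤n z≤n)
window≤∑ (suc n) f {zero} {zero} _ v≤f = +-mono-≤ (v≤f 0 z≤n z≤n) z≤n
window≤∑ (suc n) f {zero} {suc L} (s≤s L≤n) v≤f =
  +-mono-≤ (v≤f 0 z≤n z≤n) (window≤∑ n (λ j → f (suc j)) {0} {L} L≤n (λ j _ j≤L → v≤f (suc j) z≤n (s≤s j≤L)))
window≤∑ (suc n) f {suc s} (s≤s s+L≤n) v≤f =
  ≤-trans (window≤∑ n (λ j → f (suc j)) s+L≤n (λ j s≤j j≤s+L → v≤f (suc j) (s≤s s≤j) (s≤s j≤s+L))) (m≤n+m _ (f 0))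

∑≤[1+n]*bound : ∀ n (f : ℕ → ℕ) {X} → (∀ j → j ≤ n → f j ≤ X) → ∑[ j ≤ n ] f (toℕ j) ≤ suc n * X
∑≤[1+n]*bound zero    f f≤X = +-monoˡ-≤ 0 (f≤X 0 z≤n)
∑≤[1+n]*bound (suc n) f f≤X = +-mono-≤ (f≤X 0 z≤n) (∑≤[1+n]*bound n (λ j → f (suc j)) (λ j j≤n → f≤X (suc j) (s≤s j≤n)))

^′≡^ : ∀ x n → x ^′ n ≡ x ^ n
^′≡^ x zero = refl
^′≡^ x (suc n) = cong (x *_) (^′≡^ x n)

×′≡* : ∀ n x → n ×′ x ≡ n * x
×′≡* zero x = refl
×′≡* (suc n) x = cong (_+_ x) (×′≡* n x)

[x+y]^n≡∑C*x^j*y^[n∸j] : ∀ n x y → (x + y) ^ n ≡ ∑[ j ≤ n ] ((n C toℕ j) * (x ^ toℕ j * y ^ (n ∸ toℕ j)))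
[x+y]^n≡∑C*x^j*y^[n∸j] n x y = sym (^′≡^ (x + y) n) ⟨ trans ⟩ ℕ-Binomial.theorem n x y ⟨ trans ⟩ sum-cong-≗ term
  where
  term : ∀ j → ℕ-Binomial.binomialTerm x y n j ≡ (n C toℕ j) * (x ^ toℕ j * y ^ (n ∸ toℕ j))
  term j = ×′≡* (n C toℕ j) _ ⟨ trans ⟩ cong₂ (λ u v → (n C toℕ j) * (u * v)) (^′≡^ x (toℕ j)) (^′≡^ y (n ∸ toℕ j))

[k+1]*[n+1]C[k+1]≡[n+1]*nCk : ∀ n k → suc k * (suc n C suc k) ≡ suc n * (n C k)
[k+1]*[n+1]C[k+1]≡[n+1]*nCk zero    zero    = refl
[k+1]*[n+1]C[k+1]≡[n+1]*nCk zero    (suc k) = *-zeroʳ (suc (suc k))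
[k+1]*[n+1]C[k+1]≡[n+1]*nCk (suc n) zero    =
  trans (*-identityˡ _) (trans (nC1≡n (suc (suc n))) (sym (*-identityʳ (suc (suc n)))))
[k+1]*[n+1]C[k+1]≡[n+1]*nCk (suc n) (suc k) = begin
  suc (suc k) * (suc (suc n) C suc (suc k))   ≡⟨ cong (suc (suc k) *_) (nCk+nC[k+1]≡[n+1]C[k+1] (suc n) (suc k)) ⟨
  suc (suc k) * (suc n C suc k + Z)           ≡⟨ cong (λ x → suc (suc k) * (x + Z)) pascal ⟨
  suc (suc k) * (X + Y + Z)                   ≡⟨ expand k X Y Z ⟩
  suc k * (X + Y) + (X + Y) + suc (suc k) * Z ≡⟨ cong₂ (λ u v → u + (X + Y) + v) recurse₁ recurse₂ ⟩
  suc n * X + (X + Y) + suc n * Y             ≡⟨ collect n X Y ⟩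
  suc (suc n) * (X + Y)                       ≡⟨ cong (suc (suc n) *_) pascal ⟩
  suc (suc n) * (suc n C suc k)               ∎
  where
  open ≡-Reasoning
  X = n C k
  Y = n C suc k
  Z = suc n C suc (suc k)
  pascal : X + Y ≡ suc n C suc k
  pascal = nCk+nC[k+1]≡[n+1]C[k+1] n k
  recurse₁ : suc k * (X + Y) ≡ suc n * X
  recurse₁ = cong (suc k *_) pascal ⟨ trans ⟩ [k+1]*[n+1]C[k+1]≡[n+1]*nCk n k
  recurse₂ : suc (suc k) * Z ≡ suc n * Y
  recurse₂ = [k+1]*[n+1]C[k+1]≡[n+1]*nCk n (suc k)
  expand : ∀ k X Y Z → suc (suc k) * (X + Y + Z) ≡ suc k * (X + Y) + (X + Y) + suc (suc k) * Z
  expand = solve-∀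
  collect : ∀ n X Y → suc n * X + (X + Y) + suc n * Y ≡ suc (suc n) * (X + Y)
  collect = solve-∀

[k+1]*[k+e]C[k+1]≡e*[k+e]Ck : ∀ k e → suc k * ((k + e) C suc k) ≡ e * ((k + e) C k)
[k+1]*[k+e]C[k+1]≡e*[k+e]Ck k e = +-cancelˡ-≡ (suc k * X) _ _ (begin
  suc k * X + suc k * ((k + e) C suc k)  ≡⟨ *-distribˡ-+ (suc k) X _ ⟨
  suc k * ((k + e) C k + (k + e) C suc k) ≡⟨ cong (suc k *_) (nCk+nC[k+1]≡[n+1]C[k+1] (k + e) k) ⟩
  suc k * (suc (k + e) C suc k)          ≡⟨ [k+1]*[n+1]C[k+1]≡[n+1]*nCk (k + e) k ⟩
  suc (k + e) * X                        ≡⟨ *-distribʳ-+ X (suc k) e ⟩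
  suc k * X + e * X                      ∎)
  where
  open ≡-Reasoning
  X = (k + e) C k

-- Near k the consecutive ratios satisfy (a − i)/(k + i + 1) ≥ (a/k)(c/k)² and (k − i)/(a + i + 1) ≥ (k/a)(c/k)².
C-ratio-up : ∀ {k a c I i} → c + I ≡ k → k ≤ a → i < I →
             c * c * a * ((k + a) C (k + i)) ≤ k * k * k * ((k + a) C (k + suc i))
C-ratio-up {k} {a} {c} {I} {i} c+I≡k k≤a i<I = *-cancelˡ-≤ (suc (k + i)) (begin
  suc (k + i) * (c * c * a * X)  ≡⟨ rearrange c a (suc (k + i)) X ⟩
  c * c * a * suc (k + i) * X    ≤⟨ *-monoˡ-≤ X factors ⟩
  e * (k * k * k) * X            ≡⟨ rearrange′ e (k * k * k) X ⟩
  k * k * k * (e * X)            ≡⟨ cong (k * k * k *_) absorb ⟨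
  k * k * k * (suc (k + i) * Y)  ≡⟨ x∙yz≈y∙xz (k * k * k) (suc (k + i)) Y ⟩
  suc (k + i) * (k * k * k * Y)  ∎)
  where
  open ≤-Reasoning
  e = a ∸ i
  X = (k + a) C (k + i)
  Y = (k + a) C (k + suc i)
  i≤I : i ≤ I
  i≤I = <⇒≤ i<I
  i≤a : i ≤ a
  i≤a = ≤-trans i≤I (≤-trans (m≤n+m I c) (≤-trans (≤-reflexive c+I≡k) k≤a))
  absorb : suc (k + i) * Y ≡ e * X
  absorb = subst₂ (λ n j → suc (k + i) * (n C j) ≡ e * (n C (k + i)))
                  (+-assoc k i e ⟨ trans ⟩ cong (_+_ k) (m+[n∸m]≡n i≤a)) (sym (+-suc k i))
                  ([k+1]*[k+e]C[k+1]≡e*[k+e]Ck (k + i) e)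
  a*c≤e*k : a * c ≤ e * k
  a*c≤e*k = +-cancelʳ-≤ (i * k) (a * c) (e * k) (begin
    a * c + i * k  ≤⟨ +-monoʳ-≤ (a * c) (≤-trans (*-mono-≤ i≤I k≤a) (≤-reflexive (*-comm I a))) ⟩
    a * c + a * I  ≡⟨ *-distribˡ-+ a c I ⟨
    a * (c + I)    ≡⟨ cong (a *_) c+I≡k ⟩
    a * k          ≡⟨ cong (_* k) (m∸n+n≡m i≤a) ⟨
    (e + i) * k    ≡⟨ *-distribʳ-+ k e i ⟩
    e * k + i * k  ∎)
  c*[k+i+1]≤k*k : c * suc (k + i) ≤ k * k
  c*[k+i+1]≤k*k = begin
    c * suc (k + i)               ≡⟨ cong (c *_) (+-suc k i) ⟨
    c * (k + suc i)               ≤⟨ *-monoʳ-≤ c (+-monoʳ-≤ k i<I) ⟩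
    c * (k + I)                   ≤⟨ m≤m+n (c * (k + I)) (I * I) ⟩
    c * (k + I) + I * I           ≡⟨ cong (λ t → c * (t + I) + I * I) c+I≡k ⟨
    c * (c + I + I) + I * I       ≡⟨ square c I ⟩
    (c + I) * (c + I)             ≡⟨ cong₂ _*_ c+I≡k c+I≡k ⟩
    k * k                         ∎
    where
    square : ∀ c I → c * (c + I + I) + I * I ≡ (c + I) * (c + I)
    square = solve-∀
  factors : c * c * a * suc (k + i) ≤ e * (k * k * k)
  factors = begin
    c * c * a * suc (k + i)        ≡⟨ regroup c a (suc (k + i)) ⟩
    (a * c) * (c * suc (k + i))    ≤⟨ *-mono-≤ a*c≤e*k c*[k+i+1]≤k*k ⟩
    (e * k) * (k * k)              ≡⟨ regroup′ e k ⟩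
    e * (k * k * k)                ∎
    where
    regroup : ∀ c a s → c * c * a * s ≡ (a * c) * (c * s)
    regroup = solve-∀
    regroup′ : ∀ e k → (e * k) * (k * k) ≡ e * (k * k * k)
    regroup′ = solve-∀
  rearrange : ∀ c a s X → s * (c * c * a * X) ≡ c * c * a * s * X
  rearrange = solve-∀
  rearrange′ : ∀ e t X → e * t * X ≡ t * (e * X)
  rearrange′ = solve-∀

C-ratio-down : ∀ {k a c I i} → c + I ≡ k → k ≤ a → i < I →
               k * (c * c) * ((k + a) C (k ∸ i)) ≤ a * (k * k) * ((k + a) C (k ∸ suc i))
C-ratio-down {k} {a} {c} {I} {i} c+I≡k k≤a i<I = *-cancelˡ-≤ (suc j) (begin
  suc j * (k * (c * c) * X)   ≡⟨ x∙yz≈y∙xz (suc j) (k * (c * c)) X ⟩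
  k * (c * c) * (suc j * X)   ≡⟨ cong (λ t → k * (c * c) * (suc j * ((k + a) C t))) k∸i≡1+j ⟩
  k * (c * c) * (suc j * ((k + a) C suc j)) ≡⟨ cong (k * (c * c) *_) absorb ⟩
  k * (c * c) * (e * Y)       ≡⟨ regroup k c e Y ⟩
  e * c * (c * k) * Y         ≤⟨ *-monoˡ-≤ Y (*-mono-≤ e*c≤a*k (*-monoˡ-≤ k c≤1+j)) ⟩
  a * k * (suc j * k) * Y     ≡⟨ regroup′ a k (suc j) Y ⟩
  suc j * (a * (k * k) * Y)   ∎)
  where
  open ≤-Reasoning
  j = k ∸ suc i
  e = a + suc i
  X = (k + a) C (k ∸ i)
  Y = (k + a) C j
  1+i≤k : suc i ≤ k
  1+i≤k = ≤-trans i<I (≤-trans (m≤n+m I c) (≤-reflexive c+I≡k))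
  k∸i≡1+j : k ∸ i ≡ suc j
  k∸i≡1+j = +-∸-assoc 1 1+i≤k
  absorb : suc j * ((k + a) C suc j) ≡ e * Y
  absorb = subst (λ n → suc j * (n C suc j) ≡ e * (n C j))
                 (cong (_+_ j) (+-comm a (suc i)) ⟨ trans ⟩ sym (+-assoc j (suc i) a) ⟨ trans ⟩ cong (_+ a) (m∸n+n≡m 1+i≤k))
                 ([k+1]*[k+e]C[k+1]≡e*[k+e]Ck j e)
  c≤1+j : c ≤ suc j
  c≤1+j = ≤-trans (m+n≤o⇒m≤o∸n c (≤-trans (+-monoʳ-≤ c (<⇒≤ i<I)) (≤-reflexive c+I≡k))) (≤-reflexive k∸i≡1+j)
  c≤a : c ≤ a
  c≤a = ≤-trans (m≤m+n c I) (≤-trans (≤-reflexive c+I≡k) k≤a)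
  e*c≤a*k : e * c ≤ a * k
  e*c≤a*k = begin
    (a + suc i) * c    ≡⟨ *-distribʳ-+ c a (suc i) ⟩
    a * c + suc i * c  ≤⟨ +-monoʳ-≤ (a * c) (≤-trans (*-mono-≤ i<I c≤a) (≤-reflexive (*-comm I a))) ⟩
    a * c + a * I      ≡⟨ *-distribˡ-+ a c I ⟨
    a * (c + I)        ≡⟨ cong (a *_) c+I≡k ⟩
    a * k              ∎
  regroup : ∀ k c e Y → k * (c * c) * (e * Y) ≡ e * c * (c * k) * Y
  regroup = solve-∀
  regroup′ : ∀ a k s Y → a * k * (s * k) * Y ≡ s * (a * (k * k) * Y)
  regroup′ = solve-∀

C*q^j*p^[n∸j]≤mirror : ∀ {p q n j} → q ≤ p → j ≤ n → n ∸ j ≤ j →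
  (n C j) * (q ^ j * p ^ (n ∸ j)) ≤ (n C (n ∸ j)) * (q ^ (n ∸ j) * p ^ (n ∸ (n ∸ j)))
C*q^j*p^[n∸j]≤mirror {p} {q} {n} {j} q≤p j≤n n∸j≤j =
  subst₂ (λ b e → (n C j) * (q ^ j * p ^ (n ∸ j)) ≤ b * (q ^ (n ∸ j) * p ^ e))
    (nCk≡nC[n∸k] j≤n) (sym (m∸[m∸n]≡n j≤n)) (*-monoʳ-≤ (n C j) (q^j*p^o≤q^o*p^j q≤p n∸j≤j))

-- The semiring ℕ[√2] and the powers of 1 + √2

-- a + b√2 is represented by (a , b)
ℕ[√2] : Set
ℕ[√2] = ℕ × ℕ

infixl 6 _⊞_
infixl 7 _⊠_

_⊞_ : ℕ[√2] → ℕ[√2] → ℕ[√2]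
x ⊞ y = proj₁ x + proj₁ y , proj₂ x + proj₂ y

_⊠_ : ℕ[√2] → ℕ[√2] → ℕ[√2]
x ⊠ y = proj₁ x * proj₁ y + 2 * (proj₂ x * proj₂ y) , proj₁ x * proj₂ y + proj₂ x * proj₁ y

⊞-isCommutativeMonoid : IsCommutativeMonoid _⊞_ (0 , 0)
⊞-isCommutativeMonoid = isCommutativeMonoidˡ record
  { isSemigroup = record
    { isMagma = record { isEquivalence = isEquivalence ; ∙-cong = cong₂ _⊞_ }
    ; assoc = λ (a , b) (c , d) (e , f) → cong₂ _,_ (+-assoc a c e) (+-assoc b d f)
    }
  ; identityˡ = λ _ → refl
  ; comm = λ (a , b) (c , d) → cong₂ _,_ (+-comm a c) (+-comm b d)
  }

⊠-assoc : ∀ x y z → (x ⊠ y) ⊠ z ≡ x ⊠ (y ⊠ z)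
⊠-assoc (a , b) (c , d) (e , f) = cong₂ _,_ (rational a b c d e f) (irrational a b c d e f)
  where
  rational : ∀ a b c d e f → (a * c + 2 * (b * d)) * e + 2 * ((a * d + b * c) * f)
                           ≡ a * (c * e + 2 * (d * f)) + 2 * (b * (c * f + d * e))
  rational = solve-∀
  irrational : ∀ a b c d e f → (a * c + 2 * (b * d)) * f + (a * d + b * c) * e
                             ≡ a * (c * f + d * e) + b * (c * e + 2 * (d * f))
  irrational = solve-∀

⊠-comm : ∀ x y → x ⊠ y ≡ y ⊠ x
⊠-comm (a , b) (c , d) = cong₂ _,_
  (cong₂ _+_ (*-comm a c) (cong (2 *_) (*-comm b d)))
  (trans (+-comm (a * d) (b * c)) (cong₂ _+_ (*-comm b c) (*-comm a d)))

⊠-identityˡ : ∀ x → (1 , 0) ⊠ x ≡ x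
⊠-identityˡ (a , b) = cong₂ _,_ (n+0+0≡n a) (n+0+0≡n b)
  where
  n+0+0≡n : ∀ n → n + 0 + 0 ≡ n
  n+0+0≡n = solve-∀

⊠-distribʳ-⊞ : ∀ x y z → (y ⊞ z) ⊠ x ≡ y ⊠ x ⊞ z ⊠ x
⊠-distribʳ-⊞ (a , b) (c , d) (e , f) = cong₂ _,_ (rational a b c d e f) (irrational a b c d e f)
  where
  rational : ∀ a b c d e f → (c + e) * a + 2 * ((d + f) * b) ≡ (c * a + 2 * (d * b)) + (e * a + 2 * (f * b))
  rational = solve-∀
  irrational : ∀ a b c d e f → (c + e) * b + (d + f) * a ≡ (c * b + d * a) + (e * b + f * a)
  irrational = solve-∀

ℕ[√2]-commutativeSemiring : CommutativeSemiring 0ℓ 0ℓ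
ℕ[√2]-commutativeSemiring = record
  { Carrier = ℕ[√2]
  ; _≈_ = _≡_
  ; _+_ = _⊞_
  ; _*_ = _⊠_
  ; 0# = 0 , 0
  ; 1# = 1 , 0
  ; isCommutativeSemiring = isCommutativeSemiringˡ record
    { +-isCommutativeMonoid = ⊞-isCommutativeMonoid
    ; *-isCommutativeMonoid = isCommutativeMonoidˡ record
      { isSemigroup = record
        { isMagma = record { isEquivalence = isEquivalence ; ∙-cong = cong₂ _⊠_ }
        ; assoc = ⊠-assoc
        }
      ; identityˡ = ⊠-identityˡ
      ; comm = ⊠-comm
      }
    ; distribʳ = ⊠-distribʳ-⊞
    ; zeroˡ = λ _ → refl
    }
  }

open CommutativeSemiring ℕ[√2]-commutativeSemiring using (semiring)
open import Algebra.Properties.Semiring.Exp semiring using (^-homo-*; ^-assocʳ) renaming (_^_ to _⊠^_)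
open import Algebra.Properties.CommutativeSemiring.Exp ℕ[√2]-commutativeSemiring using (^-distrib-*)
import Algebra.Properties.CommutativeSemiring.Binomial ℕ[√2]-commutativeSemiring as ℕ[√2]-Binomial
open import Algebra.Properties.Semiring.Sum semiring using () renaming (sum to ∑√2)
open import Algebra.Properties.Semiring.Mult semiring using () renaming (_×_ to _×√2_)

[1+√2]^ : ℕ → ℕ[√2]
[1+√2]^ k = (1 , 1) ⊠^ k

H P : ℕ → ℕ
H k = proj₁ ([1+√2]^ k)
P k = proj₂ ([1+√2]^ k)

H-suc : ∀ k → H (suc k) ≡ H k + 2 * P k
H-suc k = cong₂ _+_ (*-identityˡ (H k)) (cong (2 *_) (*-identityˡ (P k)))

P-suc : ∀ k → P (suc k) ≡ P k + H k
P-suc k = cong₂ _+_ (*-identityˡ (P k)) (*-identityˡ (H k))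

H-+ : ∀ i j → H (i + j) ≡ H i * H j + 2 * (P i * P j)
H-+ i j = cong proj₁ (^-homo-* (1 , 1) i j)

P≤H : ∀ k → P k ≤ H k
P≤H zero = z≤n
P≤H (suc k) = begin
  P (suc k)      ≡⟨ P-suc k ⟨ trans ⟩ +-comm (P k) (H k) ⟩
  H k + P k      ≤⟨ +-monoʳ-≤ (H k) (m≤m+n (P k) (P k + 0)) ⟩
  H k + 2 * P k  ≡⟨ H-suc k ⟨
  H (suc k)      ∎
  where open ≤-Reasoning

1≤H : ∀ k → 1 ≤ H k
1≤H zero = ≤-refl
1≤H (suc k) = ≤-trans (1≤H k) (≤-trans (m≤m+n (H k) (2 * P k)) (≤-reflexive (sym (H-suc k))))

H*H≤H[+] : ∀ i j → H i * H j ≤ H (i + j)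
H*H≤H[+] i j = ≤-trans (m≤m+n _ _) (≤-reflexive (sym (H-+ i j)))

H[+]≤3*H*H : ∀ i j → H (i + j) ≤ 3 * (H i * H j)
H[+]≤3*H*H i j = begin
  H (i + j)                            ≡⟨ H-+ i j ⟩
  H i * H j + 2 * (P i * P j)          ≤⟨ +-monoʳ-≤ (H i * H j) (*-monoʳ-≤ 2 (*-mono-≤ (P≤H i) (P≤H j))) ⟩
  H i * H j + 2 * (H i * H j)          ≡⟨ x+2x≡3x (H i * H j) ⟩
  3 * (H i * H j)                      ∎
  where
  open ≤-Reasoning
  x+2x≡3x : ∀ x → x + 2 * x ≡ 3 * x
  x+2x≡3x = solve-∀

H*k^i≤[k+d]^i : ∀ {k d} → 2 * (k * k) ≤ d * d → ∀ i → H i * k ^ i ≤ (k + d) ^ i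
H*k^i≤[k+d]^i {k} {d} 2k²≤d² i = proj₁ (invariant i)
  where
  open ≤-Reasoning
  invariant : ∀ i → H i * k ^ i ≤ (k + d) ^ i × 2 * k * P i * k ^ i ≤ d * (k + d) ^ i
  invariant zero = ≤-refl , ≤-trans (≤-reflexive (trans (*-identityʳ _) (*-zeroʳ (2 * k)))) z≤n
  invariant (suc i) with invariant i
  ... | H≤ , P≤ = H′≤ , P′≤
    where
    x = k ^ i
    y = (k + d) ^ i
    H′≤ : H (suc i) * k ^ suc i ≤ (k + d) ^ suc i
    H′≤ = begin
      H (suc i) * (k * x)              ≡⟨ cong (_* (k * x)) (H-suc i) ⟩
      (H i + 2 * P i) * (k * x)        ≡⟨ expand (H i) (P i) k x ⟩
      k * (H i * x) + 2 * k * P i * x  ≤⟨ +-mono-≤ (*-monoʳ-≤ k H≤) P≤ ⟩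
      k * y + d * y                    ≡⟨ *-distribʳ-+ y k d ⟨
      (k + d) * y                      ∎
      where
      expand : ∀ h p k x → (h + 2 * p) * (k * x) ≡ k * (h * x) + 2 * k * p * x
      expand = solve-∀
    P′≤ : 2 * k * P (suc i) * k ^ suc i ≤ d * (k + d) ^ suc i
    P′≤ = begin
      2 * k * P (suc i) * (k * x)                      ≡⟨ cong (λ p → 2 * k * p * (k * x)) (P-suc i) ⟩
      2 * k * (P i + H i) * (k * x)                    ≡⟨ expand (H i) (P i) k x ⟩
      2 * (k * k) * (H i * x) + k * (2 * k * P i * x)  ≤⟨ +-mono-≤ (*-mono-≤ 2k²≤d² H≤) (*-monoʳ-≤ k P≤) ⟩
      d * d * y + k * (d * y)                          ≡⟨ collect k d y ⟩
      d * ((k + d) * y)                                ∎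
      where
      expand : ∀ h p k x → 2 * k * (p + h) * (k * x) ≡ 2 * (k * k) * (h * x) + k * (2 * k * p * x)
      expand = solve-∀
      collect : ∀ k d y → d * d * y + k * (d * y) ≡ d * ((k + d) * y)
      collect = solve-∀

[k+d]^i≤3*H*k^i : ∀ {k d} .{{_ : NonZero k}} → d * d ≤ 2 * (k * k) → ∀ i → (k + d) ^ i ≤ 3 * H i * k ^ i
[k+d]^i≤3*H*k^i {k} {d} d²≤2k² i = *-cancelʳ-≤ _ _ k (begin
  (k + d) ^ i * k                    ≤⟨ invariant i ⟩
  k ^ i * (H i * k + P i * d)        ≤⟨ *-monoʳ-≤ (k ^ i) (+-monoʳ-≤ (H i * k) (*-mono-≤ (P≤H i) d≤2k)) ⟩
  k ^ i * (H i * k + H i * (2 * k))  ≡⟨ collect (k ^ i) (H i) k ⟩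
  3 * H i * k ^ i * k                ∎)
  where
  open ≤-Reasoning
  collect : ∀ x h k → x * (h * k + h * (2 * k)) ≡ 3 * h * x * k
  collect = solve-∀
  d≤2k : d ≤ 2 * k
  d≤2k = ≮⇒≥ λ 2k<d → <⇒≱ (*-mono-< 2k<d 2k<d) (≤-trans d²≤2k² (≤-trans (m≤m+n _ _) (≤-reflexive (square k))))
    where
    square : ∀ k → 2 * (k * k) + 2 * (k * k) ≡ 2 * k * (2 * k)
    square = solve-∀
  invariant : ∀ i → (k + d) ^ i * k ≤ k ^ i * (H i * k + P i * d)
  invariant zero = ≤-reflexive (base k d)
    where
    base : ∀ k d → 1 * k ≡ 1 * (1 * k + 0 * d)
    base = solve-∀
  invariant (suc i) = begin
    (k + d) * y * k                                   ≡⟨ *-assoc (k + d) y k ⟩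
    (k + d) * (y * k)                                 ≤⟨ *-monoʳ-≤ (k + d) (invariant i) ⟩
    (k + d) * (x * (H i * k + P i * d))               ≡⟨ expand k d x (H i) (P i) ⟩
    x * (H i * k * k + (H i + P i) * d * k + P i * (d * d))        ≤⟨ *-monoʳ-≤ x (+-monoʳ-≤ _ (*-monoʳ-≤ (P i) d²≤2k²)) ⟩
    x * (H i * k * k + (H i + P i) * d * k + P i * (2 * (k * k)))  ≡⟨ collect′ k d x (H i) (P i) ⟩
    k * x * ((H i + 2 * P i) * k + (P i + H i) * d)                ≡⟨ cong₂ (λ h p → k * x * (h * k + p * d)) (H-suc i) (P-suc i) ⟨
    k * x * (H (suc i) * k + P (suc i) * d)                         ∎
    where
    x = k ^ i
    y = (k + d) ^ i
    expand : ∀ k d x h p → (k + d) * (x * (h * k + p * d)) ≡ x * (h * k * k + (h + p) * d * k + p * (d * d))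
    expand = solve-∀
    collect′ : ∀ k d x h p → x * (h * k * k + (h + p) * d * k + p * (2 * (k * k))) ≡ k * x * ((h + 2 * p) * k + (p + h) * d)
    collect′ = solve-∀

proj₁-sum : ∀ n (f : Fin n → ℕ[√2]) → proj₁ (∑√2 f) ≡ sum (λ j → proj₁ (f j))
proj₁-sum zero f = refl
proj₁-sum (suc n) f = cong (_+_ (proj₁ (f Fin.zero))) (proj₁-sum n (λ j → f (Fin.suc j)))

proj₁-×√2 : ∀ c x → proj₁ (c ×√2 x) ≡ c * proj₁ x
proj₁-×√2 zero x = refl
proj₁-×√2 (suc c) x = cong (_+_ (proj₁ x)) (proj₁-×√2 c x)

1⊠^i⊠x≡x : ∀ i x → (1 , 0) ⊠^ i ⊠ x ≡ x
1⊠^i⊠x≡x i x = cong (_⊠ x) (1⊠^i i) ⟨ trans ⟩ ⊠-identityˡ x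
  where
  1⊠^i : ∀ i → (1 , 0) ⊠^ i ≡ (1 , 0)
  1⊠^i zero = refl
  1⊠^i (suc i) = cong ((1 , 0) ⊠_) (1⊠^i i)

2⊠^ : ∀ m → (2 , 0) ⊠^ m ≡ (2 ^ m , 0)
2⊠^ zero = refl
2⊠^ (suc m) = cong (λ x → ((2 , 0) ⊠ x)) (2⊠^ m) ⟨ trans ⟩ cong (_, 0) (+-identityʳ (2 * 2 ^ m))

[2+√2]^[2m+1] : ∀ m → (2 , 1) ⊠^ (2 * m + 1) ≡ (2 ^ suc m * P (2 * m + 1) , 2 ^ m * H (2 * m + 1))
[2+√2]^[2m+1] m = begin
  ((0 , 1) ⊠ (1 , 1)) ⊠^ n           ≡⟨ ^-distrib-* (0 , 1) (1 , 1) n ⟩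
  (0 , 1) ⊠^ (2 * m + 1) ⊠ [1+√2]^ n ≡⟨ cong (_⊠ [1+√2]^ n) √2^[2m+1] ⟩
  (0 , 2 ^ m) ⊠ [1+√2]^ n            ≡⟨ cong₂ _,_ (sym (*-assoc 2 (2 ^ m) (P n))) refl ⟩
  (2 ^ suc m * P n , 2 ^ m * H n)     ∎
  where
  open ≡-Reasoning
  n = 2 * m + 1
  √2^[2m+1] : (0 , 1) ⊠^ (2 * m + 1) ≡ (0 , 2 ^ m)
  √2^[2m+1] = begin
    (0 , 1) ⊠^ (2 * m + 1)              ≡⟨ ^-homo-* (0 , 1) (2 * m) 1 ⟩
    (0 , 1) ⊠^ (2 * m) ⊠ (0 , 1)        ≡⟨ cong (_⊠ (0 , 1)) (sym (^-assocʳ (0 , 1) 2 m)) ⟩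
    (2 , 0) ⊠^ m ⊠ (0 , 1)              ≡⟨ cong (_⊠ (0 , 1)) (2⊠^ m) ⟩
    (2 ^ m , 0) ⊠ (0 , 1)               ≡⟨ cong₂ _,_ (+-identityʳ _ ⟨ trans ⟩ *-zeroʳ (2 ^ m)) (+-identityʳ _ ⟨ trans ⟩ *-identityʳ (2 ^ m)) ⟩
    (0 , 2 ^ m)                         ∎

∑-C*H≡2^[m+1]*P : ∀ m → let n = 2 * m + 1 in
  ∑[ j ≤ n ] ((n C toℕ j) * H (n ∸ toℕ j)) ≡ 2 ^ suc m * P n
∑-C*H≡2^[m+1]*P m = begin
  ∑[ j ≤ n ] ((n C toℕ j) * H (n ∸ toℕ j))  ≡⟨ sum-cong-≗ term ⟨
  ∑[ j ≤ n ] proj₁ (ℕ[√2]-Binomial.binomialTerm (1 , 0) (1 , 1) n j) ≡⟨ proj₁-sum (suc n) (ℕ[√2]-Binomial.binomialTerm (1 , 0) (1 , 1) n) ⟨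
  proj₁ (∑√2 (ℕ[√2]-Binomial.binomialTerm (1 , 0) (1 , 1) n)) ≡⟨ cong proj₁ (ℕ[√2]-Binomial.theorem n (1 , 0) (1 , 1)) ⟨
  proj₁ ((2 , 1) ⊠^ n)                    ≡⟨ cong proj₁ ([2+√2]^[2m+1] m) ⟩
  2 ^ suc m * P n                         ∎
  where
  open ≡-Reasoning
  n = 2 * m + 1
  term : ∀ j → proj₁ (ℕ[√2]-Binomial.binomialTerm (1 , 0) (1 , 1) n j) ≡ (n C toℕ j) * H (n ∸ toℕ j)
  term j = proj₁-×√2 (n C toℕ j) _ ⟨ trans ⟩ cong (λ x → (n C toℕ j) * proj₁ x) (1⊠^i⊠x≡x (toℕ j) ([1+√2]^ (n ∸ toℕ j)))

-- The upper bound

module Window {k a c I : ℕ} .{{_ : NonZero k}} (c+I≡k : c + I ≡ k) (k≤a : k ≤ a) (4I²≤k : 4 * (I * I) ≤ k) where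

  private
    n = k + a
    d = a ∸ k
    k+d≡a : k + d ≡ a
    k+d≡a = m+[n∸m]≡n k≤a
    i≤k : ∀ {i} → i ≤ I → i ≤ k
    i≤k i≤I = ≤-trans i≤I (≤-trans (m≤n+m I c) (≤-reflexive c+I≡k))
    instance
      k*k≢0 : NonZero (k * k)
      k*k≢0 = m*n≢0 k k

  [k*k]^i≤2*[c*c]^i : ∀ {i} → i ≤ I → (k * k) ^ i ≤ 2 * (c * c) ^ i
  [k*k]^i≤2*[c*c]^i {i} i≤I = subst (λ v → v ^ i ≤ 2 * (c * c) ^ i) k²
    ([u+w]^i≤2*u^i i {{subst NonZero (sym k²) k*k≢0}} (begin
      2 * (i * w)                        ≤⟨ *-monoʳ-≤ 2 (*-monoˡ-≤ w i≤I) ⟩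
      2 * (I * w)                        ≤⟨ m≤m+n _ _ ⟩
      2 * (I * w) + 2 * (I * (I * I))    ≡⟨ regroup I c ⟩
      4 * (I * I) * (c + I)              ≡⟨ cong (4 * (I * I) *_) c+I≡k ⟩
      4 * (I * I) * k                    ≤⟨ *-monoˡ-≤ k 4I²≤k ⟩
      k * k                              ≡⟨ k² ⟨
      c * c + w                          ∎))
    where
    open ≤-Reasoning
    w = I * I + 2 * c * I
    k² : c * c + w ≡ k * k
    k² = square c I ⟨ trans ⟩ cong₂ _*_ c+I≡k c+I≡k
      where
      square : ∀ c I → c * c + (I * I + 2 * c * I) ≡ (c + I) * (c + I)
      square = solve-∀
    regroup : ∀ I c → 2 * (I * (I * I + 2 * c * I)) + 2 * (I * (I * I)) ≡ 4 * (I * I) * (c + I)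
    regroup = solve-∀

  C*a^i≤2*C[k+i]*k^i : ∀ {i} → i ≤ I → (n C k) * a ^ i ≤ 2 * ((n C (k + i)) * k ^ i)
  C*a^i≤2*C[k+i]*k^i {i} i≤I = *-cancelˡ-≤ ((k * k) ^ i) {{m^n≢0 (k * k) i}} (begin
    (k * k) ^ i * ((n C k) * a ^ i)          ≤⟨ *-monoˡ-≤ _ ([k*k]^i≤2*[c*c]^i i≤I) ⟩
    2 * (c * c) ^ i * ((n C k) * a ^ i)      ≡⟨ regroup ((c * c) ^ i) (n C k) (a ^ i) ⟩
    2 * ((c * c) ^ i * a ^ i * (n C k))      ≡⟨ cong₂ (λ x y → 2 * (x * (n C y))) (^-distribʳ-* (c * c) a i) (+-identityʳ k) ⟨
    2 * ((c * c * a) ^ i * (n C (k + 0)))    ≤⟨ *-monoʳ-≤ 2 (geometric-ratio (λ j → n C (k + j)) (C-ratio-up c+I≡k k≤a) i≤I) ⟩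
    2 * ((k * k * k) ^ i * (n C (k + i)))    ≡⟨ cong (λ x → 2 * (x * (n C (k + i)))) (^-distribʳ-* (k * k) k i) ⟩
    2 * ((k * k) ^ i * k ^ i * (n C (k + i))) ≡⟨ regroup′ ((k * k) ^ i) (k ^ i) (n C (k + i)) ⟩
    (k * k) ^ i * (2 * ((n C (k + i)) * k ^ i)) ∎)
    where
    open ≤-Reasoning
    regroup : ∀ x b y → 2 * x * (b * y) ≡ 2 * (x * y * b)
    regroup = solve-∀
    regroup′ : ∀ x y b → 2 * (x * y * b) ≡ x * (2 * (b * y))
    regroup′ = solve-∀

  C*k^i≤2*C[k∸i]*a^i : ∀ {i} → i ≤ I → (n C k) * k ^ i ≤ 2 * ((n C (k ∸ i)) * a ^ i)
  C*k^i≤2*C[k∸i]*a^i {i} i≤I = *-cancelˡ-≤ ((k * k) ^ i) {{m^n≢0 (k * k) i}} (begin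
    (k * k) ^ i * ((n C k) * k ^ i)          ≤⟨ *-monoˡ-≤ _ ([k*k]^i≤2*[c*c]^i i≤I) ⟩
    2 * (c * c) ^ i * ((n C k) * k ^ i)      ≡⟨ regroup ((c * c) ^ i) (n C k) (k ^ i) ⟩
    2 * (k ^ i * (c * c) ^ i * (n C k))      ≡⟨ cong (λ x → 2 * (x * (n C k))) (^-distribʳ-* k (c * c) i) ⟨
    2 * ((k * (c * c)) ^ i * (n C k))        ≤⟨ *-monoʳ-≤ 2 (geometric-ratio (λ j → n C (k ∸ j)) (C-ratio-down c+I≡k k≤a) i≤I) ⟩
    2 * ((a * (k * k)) ^ i * (n C (k ∸ i)))  ≡⟨ cong (λ x → 2 * (x * (n C (k ∸ i)))) (^-distribʳ-* a (k * k) i) ⟩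
    2 * (a ^ i * (k * k) ^ i * (n C (k ∸ i))) ≡⟨ regroup′ (a ^ i) ((k * k) ^ i) (n C (k ∸ i)) ⟩
    (k * k) ^ i * (2 * ((n C (k ∸ i)) * a ^ i)) ∎)
    where
    open ≤-Reasoning
    regroup : ∀ x b y → 2 * x * (b * y) ≡ 2 * (y * x * b)
    regroup = solve-∀
    regroup′ : ∀ y x b → 2 * (y * x * b) ≡ x * (2 * (b * y))
    regroup′ = solve-∀

  C*H≤6*C[k+i]*H[a∸i] : ∀ {d i} → k + d ≡ a → 2 * (k * k) ≤ d * d → i ≤ I →
                         (n C k) * H a ≤ 6 * ((n C (k + i)) * H (a ∸ i))
  C*H≤6*C[k+i]*H[a∸i] {d} {i} k+d≡a 2k²≤d² i≤I = begin
    (n C k) * H a                         ≡⟨ cong (λ t → (n C k) * H t) (m∸n+n≡m i≤a) ⟨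
    (n C k) * H (a ∸ i + i)               ≤⟨ *-monoʳ-≤ (n C k) (H[+]≤3*H*H (a ∸ i) i) ⟩
    (n C k) * (3 * (H (a ∸ i) * H i))     ≡⟨ regroup (n C k) (H (a ∸ i)) (H i) ⟩
    3 * H (a ∸ i) * ((n C k) * H i)       ≤⟨ *-monoʳ-≤ (3 * H (a ∸ i)) C*H≤2*C ⟩
    3 * H (a ∸ i) * (2 * (n C (k + i)))   ≡⟨ regroup′ (H (a ∸ i)) (n C (k + i)) ⟩
    6 * ((n C (k + i)) * H (a ∸ i))       ∎
    where
    open ≤-Reasoning
    i≤a : i ≤ a
    i≤a = ≤-trans (i≤k i≤I) k≤a
    C*H≤2*C : (n C k) * H i ≤ 2 * (n C (k + i))
    C*H≤2*C = *-cancelʳ-≤ _ _ (k ^ i) {{m^n≢0 k i}} (begin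
      (n C k) * H i * k ^ i                 ≡⟨ *-assoc (n C k) (H i) (k ^ i) ⟩
      (n C k) * (H i * k ^ i)               ≤⟨ *-monoʳ-≤ (n C k) (subst (λ x → H i * k ^ i ≤ x ^ i) k+d≡a (H*k^i≤[k+d]^i 2k²≤d² i)) ⟩
      (n C k) * a ^ i                       ≤⟨ C*a^i≤2*C[k+i]*k^i i≤I ⟩
      2 * ((n C (k + i)) * k ^ i)           ≡⟨ *-assoc 2 (n C (k + i)) (k ^ i) ⟨
      2 * (n C (k + i)) * k ^ i             ∎)
    regroup : ∀ b x y → b * (3 * (x * y)) ≡ 3 * x * (b * y)
    regroup = solve-∀
    regroup′ : ∀ x b → 3 * x * (2 * b) ≡ 6 * (b * x)
    regroup′ = solve-∀

  C*H≤6*C[k∸i]*H[a+i] : ∀ {d i} → k + d ≡ a → d * d ≤ 2 * (k * k) → i ≤ I →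
                         (n C k) * H a ≤ 6 * ((n C (k ∸ i)) * H (a + i))
  C*H≤6*C[k∸i]*H[a+i] {d} {i} k+d≡a d²≤2k² i≤I = begin
    (n C k) * H a                          ≤⟨ *-monoˡ-≤ (H a) C≤6*C*H ⟩
    6 * (n C (k ∸ i)) * H i * H a          ≡⟨ regroup (n C (k ∸ i)) (H i) (H a) ⟩
    6 * ((n C (k ∸ i)) * (H a * H i))      ≤⟨ *-monoʳ-≤ 6 (*-monoʳ-≤ (n C (k ∸ i)) (H*H≤H[+] a i)) ⟩
    6 * ((n C (k ∸ i)) * H (a + i))        ∎
    where
    open ≤-Reasoning
    regroup : ∀ b x y → 6 * b * x * y ≡ 6 * (b * (y * x))
    regroup = solve-∀
    regroup′ : ∀ b h x → 2 * (b * (3 * h * x)) ≡ 6 * b * h * x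
    regroup′ = solve-∀
    a^i≤3*H*k^i : a ^ i ≤ 3 * H i * k ^ i
    a^i≤3*H*k^i = subst (λ x → x ^ i ≤ 3 * H i * k ^ i) k+d≡a ([k+d]^i≤3*H*k^i d²≤2k² i)
    C≤6*C*H : n C k ≤ 6 * (n C (k ∸ i)) * H i
    C≤6*C*H = *-cancelʳ-≤ _ _ (k ^ i) {{m^n≢0 k i}} (begin
      (n C k) * k ^ i                          ≤⟨ C*k^i≤2*C[k∸i]*a^i i≤I ⟩
      2 * ((n C (k ∸ i)) * a ^ i)              ≤⟨ *-monoʳ-≤ 2 (*-monoʳ-≤ (n C (k ∸ i)) a^i≤3*H*k^i) ⟩
      2 * ((n C (k ∸ i)) * (3 * H i * k ^ i))  ≡⟨ regroup′ (n C (k ∸ i)) (H i) (k ^ i) ⟩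
      6 * (n C (k ∸ i)) * H i * k ^ i          ∎)

  terms-near-k : ∃[ s ] s + I ≤ n × (∀ j → s ≤ j → j ≤ s + I → (n C k) * H a ≤ 6 * ((n C j) * H (n ∸ j)))
  -- 2k² ≤ d² means a ≥ (1 + √2) k: then the window lies above k, otherwise below it.
  terms-near-k with 2 * (k * k) ≤? d * d
  ... | yes 2k²≤d² = k , +-monoʳ-≤ k (≤-trans (i≤k ≤-refl) k≤a) , λ j k≤j j≤k+I →
    let i = j ∸ k
        k+i≡j = m+[n∸m]≡n k≤j
    in subst₂ (λ j′ r → (n C k) * H a ≤ 6 * ((n C j′) * H r)) k+i≡j
              (sym ([m+n]∸[m+o]≡n∸o k a i) ⟨ trans ⟩ cong (n ∸_) k+i≡j)
              (C*H≤6*C[k+i]*H[a∸i] k+d≡a 2k²≤d² (+-cancelˡ-≤ k i I (≤-trans (≤-reflexive k+i≡j) j≤k+I)))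
  ... | no 2k²≰d² = c , ≤-trans (≤-reflexive c+I≡k) (m≤m+n k a) , λ j c≤j j≤c+I →
    let i = k ∸ j
        j≤k = ≤-trans j≤c+I (≤-reflexive c+I≡k)
    in subst₂ (λ j′ r → (n C k) * H a ≤ 6 * ((n C j′) * H r)) (m∸[m∸n]≡n j≤k)
              (+-comm a i ⟨ trans ⟩ sym (+-∸-comm a j≤k))
              (C*H≤6*C[k∸i]*H[a+i] k+d≡a (<⇒≤ (≰⇒> 2k²≰d²))
                 (≤-trans (∸-monoʳ-≤ k c≤j) (≤-reflexive (cong (_∸ c) (sym c+I≡k) ⟨ trans ⟩ m+n∸m≡n c I))))

[L+1]*C≤36*2^m*H : ∀ {m k} → 1 ≤ k → k ≤ m → suc (proj₁ (half-sqrt k)) * ((2 * m + 1) C k) ≤ 36 * 2 ^ m * H k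
[L+1]*C≤36*2^m*H {m} {k} 1≤k k≤m with half-sqrt k
... | L , 4L²≤k , _ = subst (λ N → suc L * (N C k) ≤ 36 * 2 ^ m * H k) k+a≡n
  (*-cancelʳ-≤ _ _ (H a) {{>-nonZero (1≤H a)}} (begin
    suc L * ((k + a) C k) * H a                    ≡⟨ *-assoc (suc L) ((k + a) C k) (H a) ⟩
    suc L * (((k + a) C k) * H a)                  ≤⟨ window≤∑ (k + a) (λ j → 6 * term (k + a) j) {s} {L} s+L≤k+a near ⟩
    ∑[ j ≤ k + a ] (6 * term (k + a) (toℕ j))      ≡⟨ *-distribˡ-sum {suc (k + a)} 6 (λ j → term (k + a) (toℕ j)) ⟨
    6 * ∑[ j ≤ k + a ] term (k + a) (toℕ j)        ≡⟨ cong (λ N → 6 * ∑[ j ≤ N ] term N (toℕ j)) k+a≡n ⟩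
    6 * ∑[ j ≤ n ] ((n C toℕ j) * H (n ∸ toℕ j))   ≡⟨ cong (6 *_) (∑-C*H≡2^[m+1]*P m) ⟩
    6 * (2 ^ suc m * P n)                          ≤⟨ *-monoʳ-≤ 6 (*-monoʳ-≤ (2 ^ suc m) (P≤H n)) ⟩
    6 * (2 ^ suc m * H n)                          ≡⟨ cong (λ N → 6 * (2 ^ suc m * H N)) k+a≡n ⟨
    6 * (2 ^ suc m * H (k + a))                    ≤⟨ *-monoʳ-≤ 6 (*-monoʳ-≤ (2 ^ suc m) (H[+]≤3*H*H k a)) ⟩
    6 * (2 * 2 ^ m * (3 * (H k * H a)))            ≡⟨ regroup (2 ^ m) (H k) (H a) ⟩
    36 * 2 ^ m * H k * H a                         ∎))
  where
  open ≤-Reasoning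
  term : ℕ → ℕ → ℕ
  term N j = (N C j) * H (N ∸ j)
  n = 2 * m + 1
  k≤n : k ≤ n
  k≤n = ≤-trans k≤m (m≤2m+1 m)
  a = n ∸ k
  k+a≡n : k + a ≡ n
  k+a≡n = m+[n∸m]≡n k≤n
  k≤a : k ≤ a
  k≤a = +-cancelˡ-≤ k k a (begin
    k + k          ≤⟨ +-mono-≤ k≤m k≤m ⟩
    m + m          ≡⟨ cong (_+_ m) (+-identityʳ m) ⟨
    2 * m          ≤⟨ m≤m+n (2 * m) 1 ⟩
    n              ≡⟨ k+a≡n ⟨
    k + a          ∎)
  L≤k : L ≤ k
  L≤k = ≤-trans (n≤4*n*n L) 4L²≤k
    where
    n≤4*n*n : ∀ n → n ≤ 4 * (n * n)
    n≤4*n*n zero    = z≤n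
    n≤4*n*n (suc n) = ≤-trans (m≤m*n (suc n) (suc n)) (m≤n*m _ 4)
  open Window {k} {a} {k ∸ L} {L} {{>-nonZero 1≤k}} (m∸n+n≡m L≤k) k≤a 4L²≤k using (terms-near-k)
  s : ℕ
  s = proj₁ terms-near-k
  s+L≤k+a : s + L ≤ k + a
  s+L≤k+a = proj₁ (proj₂ terms-near-k)
  near : ∀ j → s ≤ j → j ≤ s + L → ((k + a) C k) * H a ≤ 6 * (((k + a) C j) * H (k + a ∸ j))
  near = proj₂ (proj₂ terms-near-k)
  regroup : ∀ x h g → 6 * (2 * x * (3 * (h * g))) ≡ 36 * x * h * g
  regroup = solve-∀

k*C²≤[72*2^m*H]² : ∀ {m k} → 1 ≤ k → k ≤ m → k * ((2 * m + 1) C k) ^ 2 ≤ (72 * 2 ^ m * H k) ^ 2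
k*C²≤[72*2^m*H]² {m} {k} 1≤k k≤m = begin
  k * Cₖ ^ 2                          ≤⟨ *-monoˡ-≤ (Cₖ ^ 2) (<⇒≤ (proj₂ (proj₂ (half-sqrt k)))) ⟩
  4 * (suc L * suc L) * Cₖ ^ 2        ≡⟨ regroup (suc L) Cₖ ⟩
  4 * (suc L * Cₖ) ^ 2                ≤⟨ *-monoʳ-≤ 4 (^-monoˡ-≤ 2 ([L+1]*C≤36*2^m*H 1≤k k≤m)) ⟩
  4 * (36 * 2 ^ m * H k) ^ 2          ≡⟨ regroup′ (2 ^ m) (H k) ⟩
  (72 * 2 ^ m * H k) ^ 2              ∎
  where
  open ≤-Reasoning
  L = proj₁ (half-sqrt k)
  Cₖ = (2 * m + 1) C k
  regroup : ∀ l c → 4 * (l * l) * (c * (c * 1)) ≡ 4 * ((l * c) * ((l * c) * 1))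
  regroup = solve-∀
  regroup′ : ∀ x h → 4 * ((36 * x * h) * ((36 * x * h) * 1)) ≡ (72 * x * h) * ((72 * x * h) * 1)
  regroup′ = solve-∀

-- Optimality of 1 + √2

exponential-gap : ∀ {p q} N .{{_ : NonZero p}} → 2 * p ^ 2 < (p + q) ^ 2 →
                  ∃[ m ] suc (2 * m + 1) * (N * 2 ^ m * p ^ (2 * m + 1)) < (p + q) ^ (2 * m + 1)
exponential-gap {p} {q} N B<A = widen (∃[m]K*m*B^m<A^m {{m*n≢0 2 (p ^ 2) {{_}} {{m^n≢0 p 2}}}} B<A (4 * N))
  where
  open ≤-Reasoning
  regroup : ∀ m N x y p → suc (2 * m + 1) * (N * x * (y * p)) ≡ (2 * m + 2) * (N * (x * y) * p)
  regroup = solve-∀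
  regroup′ : ∀ m N x p → 4 * m * (N * x * p) ≡ 4 * N * m * x * p
  regroup′ = solve-∀
  2m+2≤4m : ∀ {m} → 1 ≤ m → 2 * m + 2 ≤ 4 * m
  2m+2≤4m {m} 1≤m = ≤-trans (+-monoʳ-≤ (2 * m) (*-monoʳ-≤ 2 1≤m)) (≤-reflexive (double m))
    where
    double : ∀ m → 2 * m + 2 * m ≡ 4 * m
    double = solve-∀
  widen : (∃[ m ] 1 ≤ m × 4 * N * m * (2 * p ^ 2) ^ m < ((p + q) ^ 2) ^ m) →
          ∃[ m ] suc (2 * m + 1) * (N * 2 ^ m * p ^ (2 * m + 1)) < (p + q) ^ (2 * m + 1)
  widen (m , 1≤m , growth) = m , (begin-strict
    suc (2 * m + 1) * (N * 2 ^ m * p ^ (2 * m + 1))  ≡⟨ cong (λ x → suc (2 * m + 1) * (N * 2 ^ m * x)) (x^[2m+1]≡[x^2]^m*x p m) ⟩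
    suc (2 * m + 1) * (N * 2 ^ m * ((p ^ 2) ^ m * p)) ≡⟨ regroup m N (2 ^ m) ((p ^ 2) ^ m) p ⟩
    (2 * m + 2) * (N * (2 ^ m * (p ^ 2) ^ m) * p)   ≡⟨ cong (λ x → (2 * m + 2) * (N * x * p)) (^-distribʳ-* 2 (p ^ 2) m) ⟨
    (2 * m + 2) * (N * (2 * p ^ 2) ^ m * p)         ≤⟨ *-monoˡ-≤ _ (2m+2≤4m 1≤m) ⟩
    4 * m * (N * (2 * p ^ 2) ^ m * p)               ≡⟨ regroup′ m N ((2 * p ^ 2) ^ m) p ⟩
    4 * N * m * (2 * p ^ 2) ^ m * p                 <⟨ *-monoˡ-< p growth ⟩
    ((p + q) ^ 2) ^ m * p                           ≤⟨ *-monoʳ-≤ (((p + q) ^ 2) ^ m) (m≤m+n p q) ⟩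
    ((p + q) ^ 2) ^ m * (p + q)                     ≡⟨ x^[2m+1]≡[x^2]^m*x (p + q) m ⟨
    (p + q) ^ (2 * m + 1)                           ∎)

∃-C*q^k>Z*p^k : ∀ {p q Z} m .{{_ : NonZero Z}} → q ≤ p → suc (2 * m + 1) * (Z * p ^ (2 * m + 1)) < (p + q) ^ (2 * m + 1) →
                ∃[ k ] 1 ≤ k × k ≤ m × Z * p ^ k < ((2 * m + 1) C k) * q ^ k
∃-C*q^k>Z*p^k {p} {q} {Z} m q≤p [n+1]*Y<[p+q]ⁿ = k , s≤s z≤n , toℕ<n i , *-cancelʳ-< (p ^ (n ∸ k)) _ _ (begin-strict
  Z * p ^ k * p ^ (n ∸ k)             ≡⟨ *-assoc Z (p ^ k) (p ^ (n ∸ k)) ⟩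
  Z * (p ^ k * p ^ (n ∸ k))           ≡⟨ cong (Z *_) (sym (^-distribˡ-+-* p k (n ∸ k)) ⟨ trans ⟩ cong (p ^_) (m+[n∸m]≡n k≤n)) ⟩
  Y                                   <⟨ ≰⇒> t≰Y ⟩
  (n C k) * (q ^ k * p ^ (n ∸ k))     ≡⟨ *-assoc (n C k) (q ^ k) (p ^ (n ∸ k)) ⟨
  (n C k) * q ^ k * p ^ (n ∸ k)       ∎)
  where
  open ≤-Reasoning
  n = 2 * m + 1
  Y = Z * p ^ n
  t : ℕ → ℕ
  t j = (n C j) * (q ^ j * p ^ (n ∸ j))
  small : (∀ (i : Fin m) → t (suc (toℕ i)) ≤ Y) → ∀ j → j ≤ m → t j ≤ Y
  small all zero    _   = ≤-trans (≤-reflexive (*-identityˡ _ ⟨ trans ⟩ *-identityˡ _)) (m≤n*m (p ^ n) Z)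
  small all (suc j) j<m = subst (λ x → t (suc x) ≤ Y) (toℕ-fromℕ< j<m) (all (fromℕ< j<m))
  all-small : (∀ (i : Fin m) → t (suc (toℕ i)) ≤ Y) → ∀ j → j ≤ n → t j ≤ Y
  all-small all j j≤n with j ≤? m
  ... | yes j≤m = small all j j≤m
  ... | no j≰m = ≤-trans mirror (small all (n ∸ j) n∸j≤m)
    where
    n∸j≤m : n ∸ j ≤ m
    n∸j≤m = ≤-trans (∸-monoʳ-≤ n (≰⇒> j≰m)) (≤-reflexive ([2m+1]∸[m+1]≡m m))
    mirror : t j ≤ t (n ∸ j)
    mirror = C*q^j*p^[n∸j]≤mirror q≤p j≤n (≤-trans n∸j≤m (<⇒≤ (≰⇒> j≰m)))
  not-all-small : ¬ (∀ (i : Fin m) → t (suc (toℕ i)) ≤ Y)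
  not-all-small all = <⇒≱ [n+1]*Y<[p+q]ⁿ (begin
    (p + q) ^ n           ≡⟨ cong (_^ n) (+-comm p q) ⟩
    (q + p) ^ n           ≡⟨ [x+y]^n≡∑C*x^j*y^[n∸j] n q p ⟩
    ∑[ j ≤ n ] t (toℕ j)  ≤⟨ ∑≤[1+n]*bound n t (all-small all) ⟩
    suc n * Y             ∎)
  i : Fin m
  i = proj₁ (¬∀⟶∃¬ m _ (λ i → t (suc (toℕ i)) ≤? Y) not-all-small)
  k = suc (toℕ i)
  t≰Y : ¬ (t k ≤ Y)
  t≰Y = proj₂ (¬∀⟶∃¬ m _ (λ i → t (suc (toℕ i)) ≤? Y) not-all-small)
  k≤n : k ≤ n
  k≤n = ≤-trans (toℕ<n i) (m≤2m+1 m)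

∃-C*q^k>N*2^m*p^k : ∀ {p q} N .{{_ : NonZero N}} → q ≤ p → 2 * p ^ 2 < (p + q) ^ 2 →
                     ∃[ m ] ∃[ k ] 1 ≤ k × k ≤ m × N * 2 ^ m * p ^ k < ((2 * m + 1) C k) * q ^ k
∃-C*q^k>N*2^m*p^k {zero} N z≤n ()
∃-C*q^k>N*2^m*p^k {p@(suc _)} {q} N q≤p gap = choose (exponential-gap N gap)
  where
  choose : (∃[ m ] suc (2 * m + 1) * (N * 2 ^ m * p ^ (2 * m + 1)) < (p + q) ^ (2 * m + 1)) →
           ∃[ m ] ∃[ k ] 1 ≤ k × k ≤ m × N * 2 ^ m * p ^ k < ((2 * m + 1) C k) * q ^ k
  choose (m , gap′) = m , ∃-C*q^k>Z*p^k m {{m*n≢0 N (2 ^ m) {{it}} {{m^n≢0 2 m}}}} q≤p gap′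

-- Transfer to ℚ and ℚ(√2)

ℕ→ℚ≡mkℚ : ∀ n → ℕ→ℚ n ≡ mkℚ (+ n) 0 (Coprime.sym (Coprime.1-coprimeTo n))
ℕ→ℚ≡mkℚ n = ℚ.normalize-coprime (Coprime.sym (Coprime.1-coprimeTo n))

ℕ→ℚ-+ : ∀ a b → ℕ→ℚ (a + b) ≡ ℕ→ℚ a +ℚ ℕ→ℚ b
ℕ→ℚ-+ a b = ℚ.toℚᵘ-injective (ℚᵘ.≃-trans unnormalised (ℚᵘ.≃-sym (ℚ.toℚᵘ-homo-+ (ℕ→ℚ a) (ℕ→ℚ b))))
  where
  unnormalised : toℚᵘ (ℕ→ℚ (a + b)) ℚᵘ.≃ toℚᵘ (ℕ→ℚ a) ℚᵘ.+ toℚᵘ (ℕ→ℚ b)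
  unnormalised rewrite ℕ→ℚ≡mkℚ (a + b) | ℕ→ℚ≡mkℚ a | ℕ→ℚ≡mkℚ b = ℚᵘ.*≡* (begin
    + (a + b) ℤ.* + 1                  ≡⟨ ℤ.*-identityʳ _ ⟩
    + (a + b)                          ≡⟨ ℤ.pos-+ a b ⟩
    + a ℤ.+ + b                        ≡⟨ cong₂ ℤ._+_ (ℤ.*-identityʳ (+ a)) (ℤ.*-identityʳ (+ b)) ⟨
    + a ℤ.* + 1 ℤ.+ + b ℤ.* + 1        ≡⟨ ℤ.*-identityʳ _ ⟨
    (+ a ℤ.* + 1 ℤ.+ + b ℤ.* + 1) ℤ.* + 1 ∎)
    where open ≡-Reasoning

ℕ→ℚ-* : ∀ a b → ℕ→ℚ (a * b) ≡ ℕ→ℚ a *ℚ ℕ→ℚ b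
ℕ→ℚ-* a b = ℚ.toℚᵘ-injective (ℚᵘ.≃-trans unnormalised (ℚᵘ.≃-sym (ℚ.toℚᵘ-homo-* (ℕ→ℚ a) (ℕ→ℚ b))))
  where
  unnormalised : toℚᵘ (ℕ→ℚ (a * b)) ℚᵘ.≃ toℚᵘ (ℕ→ℚ a) ℚᵘ.* toℚᵘ (ℕ→ℚ b)
  unnormalised rewrite ℕ→ℚ≡mkℚ (a * b) | ℕ→ℚ≡mkℚ a | ℕ→ℚ≡mkℚ b = ℚᵘ.*≡* (begin
    + (a * b) ℤ.* + 1        ≡⟨ ℤ.*-identityʳ _ ⟩
    + (a * b)                ≡⟨ ℤ.pos-* a b ⟩
    + a ℤ.* + b              ≡⟨ ℤ.*-identityʳ _ ⟨
    (+ a ℤ.* + b) ℤ.* + 1    ∎)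
    where open ≡-Reasoning

ℕ→ℚ-^ : ∀ a k → ℕ→ℚ (a ^ k) ≡ ℕ→ℚ a ^ℚ k
ℕ→ℚ-^ a zero = refl
ℕ→ℚ-^ a (suc k) = ℕ→ℚ-* a (a ^ k) ⟨ trans ⟩ cong (ℕ→ℚ a *ℚ_) (ℕ→ℚ-^ a k)

ℕ→ℚ-mono-≤ : ∀ {a b} → a ≤ b → ℕ→ℚ a ≤ℚ ℕ→ℚ b
ℕ→ℚ-mono-≤ {a} {b} a≤b rewrite ℕ→ℚ≡mkℚ a | ℕ→ℚ≡mkℚ b =
  *≤* (subst₂ ℤ._≤_ (sym (ℤ.*-identityʳ (+ a))) (sym (ℤ.*-identityʳ (+ b))) (+≤+ a≤b))

ℕ→ℚ-mono-< : ∀ {a b} → a < b → ℕ→ℚ a <ℚ ℕ→ℚ b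
ℕ→ℚ-mono-< {a} {b} a<b rewrite ℕ→ℚ≡mkℚ a | ℕ→ℚ≡mkℚ b =
  *<* (subst₂ ℤ._<_ (sym (ℤ.*-identityʳ (+ a))) (sym (ℤ.*-identityʳ (+ b))) (+<+ a<b))

0≤ℕ→ℚ : ∀ n → 0ℚ ≤ℚ ℕ→ℚ n
0≤ℕ→ℚ n = ℕ→ℚ-mono-≤ (z≤n {n})

p≤q⇒0≤q-p : ∀ {p q} → p ≤ℚ q → 0ℚ ≤ℚ q - p
p≤q⇒0≤q-p {p} {q} p≤q = subst (_≤ℚ q - p) (ℚ.+-inverseʳ p) (ℚ.+-monoˡ-≤ (- p) p≤q)

0≤p⇒0≤q⇒0≤p*q : ∀ {u v} → 0ℚ ≤ℚ u → 0ℚ ≤ℚ v → 0ℚ ≤ℚ u *ℚ v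
0≤p⇒0≤q⇒0≤p*q {u} {v} 0≤u 0≤v = ℚ.nonNegative⁻¹ _ {{ℚ.nonNeg*nonNeg⇒nonNeg u {{nonNegative 0≤u}} v {{nonNegative 0≤v}}}}

0≤p⇒0≤p^k : ∀ {u} k → 0ℚ ≤ℚ u → 0ℚ ≤ℚ u ^ℚ k
0≤p⇒0≤p^k zero    0≤u = 0≤ℕ→ℚ 1
0≤p⇒0≤p^k (suc k) 0≤u = 0≤p⇒0≤q⇒0≤p*q 0≤u (0≤p⇒0≤p^k k 0≤u)

*-mono-≤-nonNeg : ∀ {u v x y} → 0ℚ ≤ℚ u → 0ℚ ≤ℚ y → u ≤ℚ v → x ≤ℚ y → u *ℚ x ≤ℚ v *ℚ y
*-mono-≤-nonNeg {u} {v} {x} {y} 0≤u 0≤y u≤v x≤y =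
  ℚ.≤-trans (ℚ.*-monoˡ-≤-nonNeg u {{nonNegative 0≤u}} x≤y) (ℚ.*-monoʳ-≤-nonNeg y {{nonNegative 0≤y}} u≤v)

^ℚ-mono-≤ : ∀ {u v} k → 0ℚ ≤ℚ u → u ≤ℚ v → u ^ℚ k ≤ℚ v ^ℚ k
^ℚ-mono-≤ zero    0≤u u≤v = ℚ.≤-refl
^ℚ-mono-≤ (suc k) 0≤u u≤v = *-mono-≤-nonNeg 0≤u (0≤p⇒0≤p^k k (ℚ.≤-trans 0≤u u≤v)) u≤v (^ℚ-mono-≤ k 0≤u u≤v)

^ℚ-distribʳ-* : ∀ u v k → (u *ℚ v) ^ℚ k ≡ u ^ℚ k *ℚ v ^ℚ k
^ℚ-distribʳ-* u v zero = sym (ℚ.*-identityˡ 1ℚ)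
^ℚ-distribʳ-* u v (suc k) = cong (u *ℚ v *ℚ_) (^ℚ-distribʳ-* u v k) ⟨ trans ⟩ swap u v (u ^ℚ k) (v ^ℚ k)
  where
  open +-*-Solver
  swap : ∀ u v x y → u *ℚ v *ℚ (x *ℚ y) ≡ u *ℚ x *ℚ (v *ℚ y)
  swap = solve 4 (λ u v x y → u :* v :* (x :* y) := u :* x :* (v :* y)) refl

x<y⇒x²<y²*k : ∀ {x y} k → 0ℚ ≤ℚ x → x <ℚ y → 1 ≤ k → x ^ℚ 2 <ℚ y ^ℚ 2 *ℚ ℕ→ℚ k
x<y⇒x²<y²*k {x} {y} k 0≤x x<y 1≤k = begin-strict
  x *ℚ (x *ℚ 1ℚ)            ≡⟨ cong (x *ℚ_) (ℚ.*-identityʳ x) ⟩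
  x *ℚ x                    ≤⟨ ℚ.*-monoˡ-≤-nonNeg x {{nonNegative 0≤x}} (ℚ.<⇒≤ x<y) ⟩
  x *ℚ y                    <⟨ ℚ.*-monoˡ-<-pos y {{positive 0<y}} x<y ⟩
  y *ℚ y                    ≡⟨ ℚ.*-identityʳ (y *ℚ y) ⟨
  y *ℚ y *ℚ 1ℚ              ≤⟨ ℚ.*-monoˡ-≤-nonNeg (y *ℚ y) {{nonNegative (0≤p⇒0≤q⇒0≤p*q (ℚ.<⇒≤ 0<y) (ℚ.<⇒≤ 0<y))}} (ℕ→ℚ-mono-≤ 1≤k) ⟩
  y *ℚ y *ℚ ℕ→ℚ k           ≡⟨ cong (λ z → y *ℚ z *ℚ ℕ→ℚ k) (ℚ.*-identityʳ y) ⟨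
  y *ℚ (y *ℚ 1ℚ) *ℚ ℕ→ℚ k   ∎
  where
  open ℚ.≤-Reasoning
  0<y : 0ℚ <ℚ y
  0<y = ℚ.≤-<-trans 0≤x x<y

embed : ℕ[√2] → ℚ√2
embed x = ℕ→ℚ (proj₁ x) + ℕ→ℚ (proj₂ x) √2

embed-⊠ : ∀ x y → embed (x ⊠ y) ≡ embed x ⊗ embed y
embed-⊠ (a , b) (c , d) = cong₂ _+_√2
  (ℕ→ℚ-+ (a * c) (2 * (b * d)) ⟨ trans ⟩ cong₂ _+ℚ_ (ℕ→ℚ-* a c) (ℕ→ℚ-* 2 (b * d) ⟨ trans ⟩ cong (ℕ→ℚ 2 *ℚ_) (ℕ→ℚ-* b d)))
  (ℕ→ℚ-+ (a * d) (b * c) ⟨ trans ⟩ cong₂ _+ℚ_ (ℕ→ℚ-* a d) (ℕ→ℚ-* b c))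

embed-⊠^ : ∀ x n → embed (x ⊠^ n) ≡ embed x ^√ n
embed-⊠^ x zero = refl
embed-⊠^ x (suc n) = embed-⊠ x (x ⊠^ n) ⟨ trans ⟩ cong (embed x ⊗_) (embed-⊠^ x n)

embed-mono : ∀ {x y} → proj₁ x ≤ proj₁ y → proj₂ x ≤ proj₂ y → embed x ≤√ embed y
embed-mono a≤c b≤d = inj₁ (p≤q⇒0≤q-p (ℕ→ℚ-mono-≤ a≤c) , p≤q⇒0≤q-p (ℕ→ℚ-mono-≤ b≤d))

proj₁²≤proj₁[x⊠^2] : ∀ x → proj₁ x ^ 2 ≤ proj₁ (x ⊠^ 2)
proj₁²≤proj₁[x⊠^2] x = begin
  proj₁ x * (proj₁ x * 1)  ≡⟨ cong (proj₁ x *_) (*-identityʳ (proj₁ x)) ⟩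
  proj₁ x * proj₁ x        ≤⟨ m≤m+n _ _ ⟩
  proj₁ (x ⊠ x)            ≡⟨ cong (λ y → proj₁ (x ⊠ y)) (⊠-comm x (1 , 0) ⟨ trans ⟩ ⊠-identityˡ x) ⟨
  proj₁ (x ⊠^ 2)           ∎
  where open ≤-Reasoning

binomial-upper-bound : ∀ m k → 1 ≤ k → k ≤ m →
  ι ((ℕ→ℚ ((2 * m + 1) C k) ^ℚ 2) *ℚ ℕ→ℚ k) ≤√ (ι (ℕ→ℚ 72 *ℚ ℕ→ℚ (2 ^ m)) ⊗ (1+√2 ^√ k)) ^√ 2
binomial-upper-bound m k 1≤k k≤m = subst₂ _≤√_ lhs rhs (embed-mono rational (z≤n {proj₂ (w ⊠^ 2)}))
  where
  open ≤-Reasoning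
  Cₖ = (2 * m + 1) C k
  w = (72 * 2 ^ m , 0) ⊠ [1+√2]^ k
  rational : Cₖ ^ 2 * k ≤ proj₁ (w ⊠^ 2)
  rational = begin
    Cₖ ^ 2 * k               ≡⟨ *-comm (Cₖ ^ 2) k ⟩
    k * Cₖ ^ 2               ≤⟨ k*C²≤[72*2^m*H]² 1≤k k≤m ⟩
    (72 * 2 ^ m * H k) ^ 2   ≡⟨ cong (_^ 2) (+-identityʳ (72 * 2 ^ m * H k)) ⟨
    proj₁ w ^ 2              ≤⟨ proj₁²≤proj₁[x⊠^2] w ⟩
    proj₁ (w ⊠^ 2)           ∎
  lhs : embed (Cₖ ^ 2 * k , 0) ≡ ι ((ℕ→ℚ Cₖ ^ℚ 2) *ℚ ℕ→ℚ k)
  lhs = cong (λ q → q + 0ℚ √2) (ℕ→ℚ-* (Cₖ ^ 2) k ⟨ trans ⟩ cong (_*ℚ ℕ→ℚ k) (ℕ→ℚ-^ Cₖ 2))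
  rhs : embed (w ⊠^ 2) ≡ (ι (ℕ→ℚ 72 *ℚ ℕ→ℚ (2 ^ m)) ⊗ (1+√2 ^√ k)) ^√ 2
  rhs = embed-⊠^ w 2 ⟨ trans ⟩ cong (_^√ 2) (embed-⊠ (72 * 2 ^ m , 0) ([1+√2]^ k) ⟨ trans ⟩
          cong₂ _⊗_ (cong (λ q → q + 0ℚ √2) (ℕ→ℚ-* 72 (2 ^ m))) (embed-⊠^ (1 , 1) k))

mkℚ*denominator : ∀ p q-1 .(c : Coprime.Coprime p (suc q-1)) → mkℚ (+ p) q-1 c *ℚ ℕ→ℚ (suc q-1) ≡ ℕ→ℚ p
mkℚ*denominator p q-1 c = ℚ.toℚᵘ-injective (ℚᵘ.≃-trans (ℚ.toℚᵘ-homo-* (mkℚ (+ p) q-1 c) (ℕ→ℚ (suc q-1))) unnormalised)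
  where
  unnormalised : toℚᵘ (mkℚ (+ p) q-1 c) ℚᵘ.* toℚᵘ (ℕ→ℚ (suc q-1)) ℚᵘ.≃ toℚᵘ (ℕ→ℚ p)
  unnormalised rewrite ℕ→ℚ≡mkℚ (suc q-1) | ℕ→ℚ≡mkℚ p = ℚᵘ.*≡* (begin
    (+ p ℤ.* + suc q-1) ℤ.* + 1   ≡⟨ ℤ.*-identityʳ _ ⟩
    + p ℤ.* + suc q-1             ≡⟨ cong (λ t → + p ℤ.* + suc t) (*-identityʳ q-1) ⟨
    + p ℤ.* + suc (q-1 * 1)       ∎)
    where open ≡-Reasoning

∃[N]≤ℕ→ℚ[1+N] : ∀ x → 0ℚ <ℚ x → ∃[ N ] x ≤ℚ ℕ→ℚ (suc N)
∃[N]≤ℕ→ℚ[1+N] (mkℚ -[1+ _ ] _ _) (*<* ())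
∃[N]≤ℕ→ℚ[1+N] (mkℚ (+ n) d-1 c) _ = n , n/d≤1+n
  where
  n/d≤1+n : mkℚ (+ n) d-1 c ≤ℚ ℕ→ℚ (suc n)
  n/d≤1+n rewrite ℕ→ℚ≡mkℚ (suc n) =
    *≤* (subst₂ ℤ._≤_ (sym (ℤ.*-identityʳ (+ n))) (ℤ.pos-* (suc n) (suc d-1)) (+≤+ (≤-trans (n≤1+n n) (m≤m*n (suc n) (suc d-1)))))

∃-fraction-above : ∀ b → 0ℚ <ℚ b → ι b <√ 1+√2 →
                   ∃[ p ] ∃[ q ] q ≤ p × 2 * p ^ 2 < (p + q) ^ 2 × b *ℚ ℕ→ℚ q ≤ℚ ℕ→ℚ p
∃-fraction-above (mkℚ -[1+ _ ] _ _) (*<* ())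
∃-fraction-above b@(mkℚ (+ p) q-1 c) _ (_ , 1+√2≰b) with suc q-1 ≤? p
... | no q≰p = q , q , ≤-refl , subst (λ x → 2 * x ^ 2 < (x + q) ^ 2) (+-identityʳ q) (2[q+d]²<[q+d+q]² {q} {0} (s≤s z≤n)) ,
               ℚ.≤-trans (ℚ.≤-reflexive b*q≡p) (ℕ→ℚ-mono-≤ (<⇒≤ (≰⇒> q≰p)))
  where
  q = suc q-1
  b*q≡p : b *ℚ ℕ→ℚ q ≡ ℕ→ℚ p
  b*q≡p = mkℚ*denominator p q-1 c
... | yes q≤p = p , q , q≤p , subst (λ x → 2 * x ^ 2 < (x + q) ^ 2) q+d≡p (2[q+d]²<[q+d+q]² {q} {d} d²<2q²) , ℚ.≤-reflexive b*q≡p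
  where
  open +-*-Solver
  q = suc q-1
  d = p ∸ q
  q+d≡p : q + d ≡ p
  q+d≡p = m+[n∸m]≡n q≤p
  0<q : 0 < q
  0<q = s≤s z≤n
  b*q≡p : b *ℚ ℕ→ℚ q ≡ ℕ→ℚ p
  b*q≡p = mkℚ*denominator p q-1 c
  instance
    q>0 : Positive (ℕ→ℚ q)
    q>0 = positive (ℕ→ℚ-mono-< 0<q)
  w = b - 1ℚ
  w*q≡d : w *ℚ ℕ→ℚ q ≡ ℕ→ℚ d
  w*q≡d = begin
    (b - 1ℚ) *ℚ ℕ→ℚ q             ≡⟨ distrib b (ℕ→ℚ q) ⟩
    b *ℚ ℕ→ℚ q - ℕ→ℚ q            ≡⟨ cong (_- ℕ→ℚ q) (b*q≡p ⟨ trans ⟩ cong ℕ→ℚ (sym q+d≡p) ⟨ trans ⟩ ℕ→ℚ-+ q d) ⟩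
    (ℕ→ℚ q +ℚ ℕ→ℚ d) - ℕ→ℚ q      ≡⟨ cancel (ℕ→ℚ q) (ℕ→ℚ d) ⟩
    ℕ→ℚ d                         ∎
    where
    open ≡-Reasoning
    distrib : ∀ b y → (b - 1ℚ) *ℚ y ≡ b *ℚ y - y
    distrib = solve 2 (λ b y → (b :- con 1ℚ) :* y := b :* y :- y) refl
    cancel : ∀ y z → (y +ℚ z) - y ≡ z
    cancel = solve 2 (λ y z → (y :+ z) :- y := z) refl
  0≤w : 0ℚ ≤ℚ w
  0≤w = ℚ.*-cancelʳ-≤-pos (ℕ→ℚ q)
          (ℚ.≤-trans (ℚ.≤-reflexive (ℚ.*-zeroˡ (ℕ→ℚ q))) (ℚ.≤-trans (0≤ℕ→ℚ d) (ℚ.≤-reflexive (sym w*q≡d))))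
  d²<2q² : d * d < 2 * (q * q)
  d²<2q² with d * d <? 2 * (q * q)
  ... | yes d²<2q² = d²<2q²
  ... | no d²≮2q² = ⊥-elim (1+√2≰b (inj₂ (inj₁ (0≤w , *<* ℤ.-<+ , 2≤w²))))
    where
    square : ∀ w y → (w *ℚ y) *ℚ (w *ℚ y) ≡ (w *ℚ w) *ℚ (y *ℚ y)
    square = solve 2 (λ w y → (w :* y) :* (w :* y) := (w :* w) :* (y :* y)) refl
    2≤w² : ℕ→ℚ 2 *ℚ ((0ℚ - 1ℚ) *ℚ (0ℚ - 1ℚ)) ≤ℚ w *ℚ w
    2≤w² = ℚ.*-cancelʳ-≤-pos (ℕ→ℚ (q * q)) {{positive (ℕ→ℚ-mono-< (*-mono-< 0<q 0<q))}} (begin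
      ℕ→ℚ 2 *ℚ ℕ→ℚ (q * q)                  ≡⟨ ℕ→ℚ-* 2 (q * q) ⟨
      ℕ→ℚ (2 * (q * q))                     ≤⟨ ℕ→ℚ-mono-≤ (≮⇒≥ d²≮2q²) ⟩
      ℕ→ℚ (d * d)                           ≡⟨ ℕ→ℚ-* d d ⟩
      ℕ→ℚ d *ℚ ℕ→ℚ d                        ≡⟨ cong₂ _*ℚ_ w*q≡d w*q≡d ⟨
      (w *ℚ ℕ→ℚ q) *ℚ (w *ℚ ℕ→ℚ q)          ≡⟨ square w (ℕ→ℚ q) ⟩
      (w *ℚ w) *ℚ (ℕ→ℚ q *ℚ ℕ→ℚ q)          ≡⟨ cong ((w *ℚ w) *ℚ_) (ℕ→ℚ-* q q) ⟨
      (w *ℚ w) *ℚ ℕ→ℚ (q * q)               ∎)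
      where open ℚ.≤-Reasoning

C′*2^m*b^k<C : ∀ {C′ b} N p q B m k → 0ℚ ≤ℚ C′ → 0ℚ ≤ℚ b → C′ ≤ℚ ℕ→ℚ N → b *ℚ ℕ→ℚ q ≤ℚ ℕ→ℚ p →
               N * 2 ^ m * p ^ k < B * q ^ k → C′ *ℚ ℕ→ℚ (2 ^ m) *ℚ b ^ℚ k <ℚ ℕ→ℚ B
C′*2^m*b^k<C {C′} {b} N p q B m k 0≤C′ 0≤b C′≤N b*q≤p N*2^m*p^k<B*q^k =
  ℚ.*-cancelʳ-<-nonNeg (ℕ→ℚ (q ^ k)) {{nonNegative (0≤ℕ→ℚ (q ^ k))}} (begin-strict
    C′ *ℚ ℕ→ℚ (2 ^ m) *ℚ b ^ℚ k *ℚ ℕ→ℚ (q ^ k)        ≡⟨ ℚ.*-assoc (C′ *ℚ ℕ→ℚ (2 ^ m)) (b ^ℚ k) (ℕ→ℚ (q ^ k)) ⟩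
    C′ *ℚ ℕ→ℚ (2 ^ m) *ℚ (b ^ℚ k *ℚ ℕ→ℚ (q ^ k))      ≤⟨ *-mono-≤-nonNeg (0≤p⇒0≤q⇒0≤p*q 0≤C′ (0≤ℕ→ℚ (2 ^ m))) (0≤ℕ→ℚ (p ^ k))
                                                          (ℚ.*-monoʳ-≤-nonNeg (ℕ→ℚ (2 ^ m)) {{nonNegative (0≤ℕ→ℚ (2 ^ m))}} C′≤N) b^k*q^k≤p^k ⟩
    ℕ→ℚ N *ℚ ℕ→ℚ (2 ^ m) *ℚ ℕ→ℚ (p ^ k)               ≡⟨ cong (_*ℚ ℕ→ℚ (p ^ k)) (ℕ→ℚ-* N (2 ^ m)) ⟨
    ℕ→ℚ (N * 2 ^ m) *ℚ ℕ→ℚ (p ^ k)                    ≡⟨ ℕ→ℚ-* (N * 2 ^ m) (p ^ k) ⟨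
    ℕ→ℚ (N * 2 ^ m * p ^ k)                           <⟨ ℕ→ℚ-mono-< N*2^m*p^k<B*q^k ⟩
    ℕ→ℚ (B * q ^ k)                                   ≡⟨ ℕ→ℚ-* B (q ^ k) ⟩
    ℕ→ℚ B *ℚ ℕ→ℚ (q ^ k)                              ∎)
  where
  open ℚ.≤-Reasoning
  b^k*q^k≤p^k : b ^ℚ k *ℚ ℕ→ℚ (q ^ k) ≤ℚ ℕ→ℚ (p ^ k)
  b^k*q^k≤p^k = begin
    b ^ℚ k *ℚ ℕ→ℚ (q ^ k)     ≡⟨ cong (b ^ℚ k *ℚ_) (ℕ→ℚ-^ q k) ⟩
    b ^ℚ k *ℚ ℕ→ℚ q ^ℚ k      ≡⟨ ^ℚ-distribʳ-* b (ℕ→ℚ q) k ⟨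
    (b *ℚ ℕ→ℚ q) ^ℚ k         ≤⟨ ^ℚ-mono-≤ k (0≤p⇒0≤q⇒0≤p*q 0≤b (0≤ℕ→ℚ q)) b*q≤p ⟩
    ℕ→ℚ p ^ℚ k                ≡⟨ ℕ→ℚ-^ p k ⟨
    ℕ→ℚ (p ^ k)               ∎

no-smaller-base : (b : ℚ) → 0ℚ <ℚ b → ι b <√ 1+√2 →
  ¬ (Σ ℚ λ C′ → 0ℚ <ℚ C′ ×
      ((m k : ℕ) → 1 ≤ m → 1 ≤ k → k ≤ m →
        (ℕ→ℚ ((2 * m + 1) C k) ^ℚ 2) *ℚ ℕ→ℚ k ≤ℚ (C′ *ℚ ℕ→ℚ (2 ^ m) *ℚ (b ^ℚ k)) ^ℚ 2))
no-smaller-base b 0<b b<1+√2 (C′ , 0<C′ , bound) =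
  refute (∃-fraction-above b 0<b b<1+√2) (∃[N]≤ℕ→ℚ[1+N] C′ 0<C′)
  where
  0≤C′ : 0ℚ ≤ℚ C′
  0≤C′ = ℚ.<⇒≤ 0<C′
  0≤b : 0ℚ ≤ℚ b
  0≤b = ℚ.<⇒≤ 0<b
  refute : (∃[ p ] ∃[ q ] q ≤ p × 2 * p ^ 2 < (p + q) ^ 2 × b *ℚ ℕ→ℚ q ≤ℚ ℕ→ℚ p) → (∃[ N ] C′ ≤ℚ ℕ→ℚ (suc N)) → ⊥
  refute (p , q , q≤p , 2p²<[p+q]² , b*q≤p) (N , C′≤1+N) = refute′ (∃-C*q^k>N*2^m*p^k (suc N) q≤p 2p²<[p+q]²)
    where
    refute′ : (∃[ m ] ∃[ k ] 1 ≤ k × k ≤ m × suc N * 2 ^ m * p ^ k < ((2 * m + 1) C k) * q ^ k) → ⊥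
    refute′ (m , k , 1≤k , k≤m , large) = ℚ.<-irrefl refl (ℚ.<-≤-trans x²<C²k (bound m k (≤-trans 1≤k k≤m) 1≤k k≤m))
      where
      0≤x : 0ℚ ≤ℚ C′ *ℚ ℕ→ℚ (2 ^ m) *ℚ b ^ℚ k
      0≤x = 0≤p⇒0≤q⇒0≤p*q (0≤p⇒0≤q⇒0≤p*q 0≤C′ (0≤ℕ→ℚ (2 ^ m))) (0≤p⇒0≤p^k k 0≤b)
      x<C : C′ *ℚ ℕ→ℚ (2 ^ m) *ℚ b ^ℚ k <ℚ ℕ→ℚ ((2 * m + 1) C k)
      x<C = C′*2^m*b^k<C (suc N) p q ((2 * m + 1) C k) m k 0≤C′ 0≤b C′≤1+N b*q≤p large
      x²<C²k : (C′ *ℚ ℕ→ℚ (2 ^ m) *ℚ b ^ℚ k) ^ℚ 2 <ℚ (ℕ→ℚ ((2 * m + 1) C k) ^ℚ 2) *ℚ ℕ→ℚ k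
      x²<C²k = x<y⇒x²<y²*k k 0≤x x<C 1≤k

lemma3p4 : (Σ ℚ λ c → 0ℚ <ℚ c ×
    ((m k : ℕ) → 1 ≤ m → 1 ≤ k → k ≤ m →
      ι ((ℕ→ℚ ((2 * m + 1) C k) ^ℚ 2) *ℚ ℕ→ℚ k)
        ≤√ (ι (c *ℚ ℕ→ℚ (2 ^ m)) ⊗ (1+√2 ^√ k)) ^√ 2))
  ×
  ((b : ℚ) → 0ℚ <ℚ b → ι b <√ 1+√2 →
    ¬ (Σ ℚ λ C′ → 0ℚ <ℚ C′ ×
        ((m k : ℕ) → 1 ≤ m → 1 ≤ k → k ≤ m →
          (ℕ→ℚ ((2 * m + 1) C k) ^ℚ 2) *ℚ ℕ→ℚ k
            ≤ℚ (C′ *ℚ ℕ→ℚ (2 ^ m) *ℚ (b ^ℚ k)) ^ℚ 2)))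
lemma3p4 = (ℕ→ℚ 72 , ℕ→ℚ-mono-< (s≤s (z≤n {71})) , λ m k _ → binomial-upper-bound m k) , no-smaller-base
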